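{- For every shape $\lambda$, the set of Young tableaux over $[n]$ of shape $\lambda$ (respectively, the set of quasi-ribbon tableaux over $[n]$ of shape $\lambda$) forms a single connected component, with a unique highest-weight element, for the crystal structure $(\mathbf{e}_i,\mathbf{f}_i)_{i\in[n-1]}$ on row connected, row increasing strings of columns described below.
   Context: Fix $n\geq1$, $[n]=\{1<\dots<n\}$. A column is a finite strictly increasing sequence $c=(c^1<\dots<c^k)$ in $[n]$, drawn as vertically stacked boxes with entries increasing downward; $|c|=k$. A string of columns $c_1|_{p_1}c_2\cdots|_{p_m}c_{m+1}$ ($p_i\in\mathbb{Z}$) places the columns in consecutive positions from left to right; if $c_i$ occupies rows $a,\dots,a+|c_i|-1$ (rows indexed downward), then $c_{i+1}$ occupies rows $a+p_i-|c_{i+1}|,\dots,a+p_i-1$. It is row connected if in every row the boxes lie in consecutive columns, and row increasing if entries weakly increase left to right along each row; $\mathrm{Scol}^{\leq}(n)$ denotes the set of such strings. The shape of such a string with $k$ rows is $(\lambda_1,\dots,\lambda_k)$ where $\lambda_i$ is the number of boxes in the $i$-th row from the top. A Young tableau is an element of $\mathrm{Scol}^{\le}(n)$ with $p_k=|c_{k+1}|$ for all $k$ and weakly decreasing gluing sequence (columns top-aligned, lengths weakly decreasing left to right). A quasi-ribbon tableau is an element of $\mathrm{Scol}^{\le}(n)$ with $p_k=|c_k|+|c_{k+1}|-1$ for all $k$ (the top box of $c_{k+1}$ is in the same row as, and immediately right of, the bottom box of $c_k$). Crystal operators: for $i\in[n-1]$ and $w\in\mathrm{Scol}^{\leq}(n)$,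 replace each column of $w$, from left to right, by $+$ if it contains $i$ but not $i+1$, by $-$ if it contains $i+1$ but not $i$, and by nothing otherwise; repeatedly delete factors $-+$ until a word $+^r-^l$ remains. If $r>0$, let $d$ be obtained from $w$ by replacing the entry $i$ by $i+1$ in the column corresponding to the rightmost remaining $+$; $\mathbf{f}_i(w)=d$ if $d\in\mathrm{Scol}^{\le}(n)$, else $0$; if $r=0$, $\mathbf{f}_i(w)=0$. If $l>0$, let $d'$ be obtained by replacing the entry $i+1$ by $i$ in the column corresponding to the leftmost remaining $-$; $\mathbf{e}_i(w)=d'$ if $d'\in\mathrm{Scol}^{\le}(n)$, else $0$; if $l=0$, $\mathbf{e}_i(w)=0$. Connected components are taken in the graph on $\mathrm{Scol}^{\leq}(n)$ with arrows $w\xrightarrow{i}\mathbf{f}_i(w)$ whenever $\mathbf{f}_i(w)\ne0$. An element $w$ is of highest weight if $\mathbf{e}_i(w)=0$ for all $i$. -}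

module Defs where

open import Data.Nat using (ℕ; zero; suc; _≤_; _<_; _≥_; _≡ᵇ_)
open import Data.Integer as ℤ using (ℤ; +_; _+_; _-_; _⊓_; _⊔_)
open import Data.List using (List; []; _∷_; _++_; map; length; filter; upTo; foldr; head; last)
open import Data.Bool.ListAction using (any)
open import Data.List.Membership.Propositional using (_∈_)
open import Data.List.Relation.Unary.All using (All)
open import Data.List.Relation.Unary.Linked using (Linked)
open import Data.Product using (_×_; _,_; proj₁; proj₂; ∃; Σ)
open import Data.Maybe using (Maybe; just; nothing)
open import Data.Bool using (Bool; true; false; if_then_else_; _∧_; not)
open import Data.Unit using (⊤)
open import Relation.Binary.PropositionalEquality using (_≡_)
open import Relation.Binary.Construct.Closure.Equivalence using (EqClosure)
open import Relation.Nullary using (¬_)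
open import Function.Bundles using (_⇔_)

-- Columns and strings of columns.
-- Entries are natural numbers; validity (1 ≤ x ≤ n, strictly increasing,
-- nonempty) is imposed in ValidCol.

Col : Set
Col = List ℕ

-- c₁ |_{p₁} c₂ |_{p₂} ... c_{m+1}  is  mkSCol c₁ ((p₁ , c₂) ∷ (p₂ , c₃) ∷ ...)
record SCol : Set where
  constructor mkSCol
  field
    first : Col
    rest  : List (ℤ × Col)
open SCol public

columns : SCol → List Col
columns w = first w ∷ map proj₂ (rest w)

len : Col → ℤ
len c = + length c

-- top rows (rows indexed downward); the first column has top row 0,
-- and if c_i has top row a then c_{i+1} has top row a + p_i - |c_{i+1}|.
topsFrom : ℤ → List (ℤ × Col) → List ℤ
topsFrom a [] = []
topsFrom a ((p , c) ∷ rs) = (a + p - len c) ∷ topsFrom (a + p - len c) rs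

tops : SCol → List ℤ
tops w = + 0 ∷ topsFrom (+ 0) (rest w)

-- a box: (row , column position , entry)
Box : Set
Box = ℤ × ℕ × ℕ

colBoxes : ℤ → ℕ → Col → List Box
colBoxes t j [] = []
colBoxes t j (x ∷ xs) = (t , j , x) ∷ colBoxes (t + + 1) j xs

boxesFrom : ℕ → List ℤ → List Col → List Box
boxesFrom j (t ∷ ts) (c ∷ cs) = colBoxes t j c ++ boxesFrom (suc j) ts cs
boxesFrom j _ _ = []

boxes : SCol → List Box
boxes w = boxesFrom 0 (tops w) (columns w)

ValidCol : ℕ → Col → Set
ValidCol n c = (¬ c ≡ []) × Linked _<_ c × All (λ x → 1 ≤ x × x ≤ n) c

RowConnected : SCol → Set
RowConnected w = ∀ {r j j′ k x y} →
  (r , j , x) ∈ boxes w → (r , j′ , y) ∈ boxes w → j < k → k < j′ →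
  ∃ λ z → (r , k , z) ∈ boxes w

RowIncreasing : SCol → Set
RowIncreasing w = ∀ {r j j′ x y} →
  (r , j , x) ∈ boxes w → (r , j′ , y) ∈ boxes w → j < j′ → x ≤ y

InScol : ℕ → SCol → Set
InScol n w = All (ValidCol n) (columns w) × RowConnected w × RowIncreasing w

countRow : ℤ → List Box → ℕ
countRow r bs = length (filter (λ b → proj₁ b ℤ.≟ r) bs)

shape : SCol → List ℕ
shape w with map proj₁ (boxes w)
... | [] = []
... | r ∷ rs =
  map (λ k → countRow (foldr _⊓_ r rs + + k) (boxes w))
      (upTo (suc ℤ.∣ foldr _⊔_ r rs - foldr _⊓_ r rs ∣))

YoungTableau : ℕ → SCol → Set
YoungTableau n w =
  InScol n w
  × All (λ pc → proj₁ pc ≡ len (proj₂ pc)) (rest w)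
  × Linked _≥_ (map length (columns w))

QRGlue : Col → List (ℤ × Col) → Set
QRGlue c [] = ⊤
QRGlue c ((p , c′) ∷ rs) = (p ≡ len c + len c′ - + 1) × QRGlue c′ rs

QuasiRibbonTableau : ℕ → SCol → Set
QuasiRibbonTableau n w = InScol n w × QRGlue (first w) (rest w)

data Sign : Set where
  plus minus : Sign

mem : ℕ → Col → Bool
mem i c = any (λ x → x ≡ᵇ i) c

signOf : ℕ → Col → List Sign
signOf i c with mem i c | mem (suc i) c
... | true  | false = plus ∷ []
... | false | true  = minus ∷ []
... | _     | _     = []

signWordFrom : ℕ → ℕ → List Col → List (ℕ × Sign)
signWordFrom i j [] = []
signWordFrom i j (c ∷ cs) = map (λ s → (j , s)) (signOf i c) ++ signWordFrom i (suc j) cs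

signWord : ℕ → SCol → List (ℕ × Sign)
signWord i w = signWordFrom i 0 (columns w)

-- Repeated deletion of factors "-+" (bracket matching).  Returns
-- (remaining + positions, most recent first ; remaining - positions, most recent first).
reduce : List (ℕ × Sign) → List ℕ → List ℕ → List ℕ × List ℕ
reduce [] ps ms = ps , ms
reduce ((j , plus) ∷ s) ps [] = reduce s (j ∷ ps) []
reduce ((j , plus) ∷ s) ps (m ∷ ms) = reduce s ps ms
reduce ((j , minus) ∷ s) ps ms = reduce s ps (j ∷ ms)

remaining : ℕ → SCol → List ℕ × List ℕ
remaining i w = reduce (signWord i w) [] []

replaceEntry : ℕ → ℕ → Col → Col
replaceEntry a b = map (λ x → if x ≡ᵇ a then b else x)

modifyRest : ℕ → (Col → Col) → List (ℤ × Col) → List (ℤ × Col)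
modifyRest j g [] = []
modifyRest zero g ((p , c) ∷ rs) = (p , g c) ∷ rs
modifyRest (suc j) g (pc ∷ rs) = pc ∷ modifyRest j g rs

modifyCol : ℕ → (Col → Col) → SCol → SCol
modifyCol zero g (mkSCol c rs) = mkSCol (g c) rs
modifyCol (suc j) g (mkSCol c rs) = mkSCol c (modifyRest j g rs)

-- candidate d for f_i (rightmost remaining +)
fCand : ℕ → SCol → Maybe SCol
fCand i w with head (proj₁ (remaining i w))
... | nothing = nothing
... | just j  = just (modifyCol j (replaceEntry i (suc i)) w)

-- candidate d' for e_i (leftmost remaining -)
eCand : ℕ → SCol → Maybe SCol
eCand i w with last (proj₂ (remaining i w))
... | nothing = nothing
... | just j  = just (modifyCol j (replaceEntry (suc i) i) w)

-- f_i(w) = d ≠ 0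
FStep : ℕ → ℕ → SCol → SCol → Set
FStep n i w d = fCand i w ≡ just d × InScol n d

-- e_i(w) = d ≠ 0
EStep : ℕ → ℕ → SCol → SCol → Set
EStep n i w d = eCand i w ≡ just d × InScol n d

ValidIndex : ℕ → ℕ → Set
ValidIndex n i = 1 ≤ i × i < n

Arrow : ℕ → SCol → SCol → Set
Arrow n w d = InScol n w × Σ ℕ (λ i → ValidIndex n i × FStep n i w d)

Connected : ℕ → SCol → SCol → Set
Connected n = EqClosure (Arrow n)

HighestWeight : ℕ → SCol → Set
HighestWeight n h = InScol n h × (∀ i → ValidIndex n i → ∀ d → ¬ EStep n i h d)

IsComponentWithUniqueHW : ℕ → (SCol → Set) → SCol → Set
IsComponentWithUniqueHW n P w =
  (∀ v → (P v × shape v ≡ shape w) ⇔ Connected n w v)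
  × ∃ λ h → Connected n w h × HighestWeight n h
            × (∀ h′ → Connected n w h′ → HighestWeight n h′ → h′ ≡ h)

-- Call a box in row r (rows counted from 0) placed if it holds r + 1. In a Young or a quasi-ribbon
-- tableau every box of row r holds at least r + 1, and the superstandard tableau of the same geometry,
-- all of whose boxes are placed, has highest weight and is determined by the shape. Otherwise let i + 1
-- be the least misplaced entry, in the leftmost column where it is misplaced: the columns to its left
-- contribute only + and those to its right only − to the i-signature, so e_i lowers exactly this entry,
-- the result is again a tableau of the same kind and shape, and f_i undoes the step. As an arrow changes
-- a single column entrywise, the kind of tableau, the shape and the superstandard tableau are invariant
-- along arrows; descending on the sum of the entries connects every tableau to its superstandard one,
-- and a highest-weight element cannot have a misplaced box.

module Submission where

open import Defs
open import Data.Bool using (T; false; if_then_else_; true)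
open import Data.Bool.Properties using (∨-zeroʳ)
open import Data.Empty using (⊥; ⊥-elim)
open import Data.Integer as ℤ using (+_; ℤ)
import Data.Integer.Properties as ℤₚ
open import Data.Integer.Tactic.RingSolver using (solve-∀)
open import Data.List using (List; []; _++_; _∷_; applyUpTo; filter; foldr; head; last; length; map; upTo)
open import Data.List.Membership.Propositional using (_∈_; find; lose)
open import Data.List.Membership.Propositional.Properties using (∈-++⁺ʳ; ∈-++⁺ˡ; ∈-++⁻; ∈-map⁺; ∈-map⁻)
open import Data.List.Properties using (++-assoc; filter-++; length-++; length-applyUpTo; length-map; map-++; map-cong; map-∘; ∷-injectiveʳ; ∷-injectiveˡ)
open import Data.List.Relation.Unary.All as All using (All; []; _∷_)
open import Data.List.Relation.Unary.All.Properties using (++⁺; map⁺)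
open import Data.List.Relation.Unary.Any using (Any; any?; here; there)
open import Data.List.Relation.Unary.Linked as Linked using (Linked; [-]; []; _∷_)
open import Data.List.Relation.Unary.Linked.Properties using (Linked⇒All)
open import Data.Maybe using (just)
open import Data.Nat using (_+_; _<?_; _<_; _≟_; _≡ᵇ_; _≤?_; _≤_; _≥_; _⊔_; pred; suc; s≤s; zero; z≤n; ℕ)
open import Data.Nat.Induction using (<-rec; <-wellFounded)
open import Data.Nat.ListAction using (sum)
open import Data.Nat.Properties
open import Data.Product using (_,_; _×_; proj₁; proj₂; ∃; ∃₂)
open import Data.Sum using (_⊎_; inj₁; inj₂)
open import Function using (_∘_; _∘′_; flip)
open import Function.Bundles using (mk⇔)
import Induction.WellFounded as WF
open import Relation.Binary.Construct.Closure.Equivalence using (symmetric)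
open import Relation.Binary.Construct.Closure.ReflexiveTransitive using (_◅_; _◅◅_; ε)
open import Relation.Binary.Construct.Closure.Symmetric using (bwd; fwd)
import Relation.Binary.Construct.On as On
open import Relation.Binary.Definitions using (tri<; tri>; tri≈)
open import Relation.Binary.PropositionalEquality
open import Relation.Nullary using (does; no; yes; ¬_)
open import Relation.Nullary.Decidable using (_×-dec_)
open import Relation.Unary using (Decidable)

infix 4 _[_]=_

data _[_]=_ {A : Set} : List A → ℕ → A → Set where
  here  : ∀ {x xs} → (x ∷ xs) [ 0 ]= x
  there : ∀ {x xs k y} → xs [ k ]= y → (x ∷ xs) [ suc k ]= y

module _ {A : Set} where

  []=-functional : ∀ {xs : List A} {k a b} → xs [ k ]= a → xs [ k ]= b → a ≡ b
  []=-functional here      here      = refl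
  []=-functional (there p) (there q) = []=-functional p q

  []=⇒<length : ∀ {xs : List A} {k a} → xs [ k ]= a → k < length xs
  []=⇒<length here      = s≤s z≤n
  []=⇒<length (there p) = s≤s ([]=⇒<length p)

  <length⇒[]= : ∀ {xs : List A} {k} → k < length xs → ∃ λ a → xs [ k ]= a
  <length⇒[]= {x ∷ xs} {zero}  _         = x , here
  <length⇒[]= {x ∷ xs} {suc k} (s≤s k<) with <length⇒[]= k<
  ... | a , p = a , there p

  []=-downward : ∀ {xs : List A} {k a k′} → xs [ k ]= a → k′ ≤ k → ∃ λ b → xs [ k′ ]= b
  []=-downward p k′≤k = <length⇒[]= (≤-<-trans k′≤k ([]=⇒<length p))

  []=-head : ∀ {xs : List A} → ¬ xs ≡ [] → ∃ λ a → xs [ 0 ]= a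
  []=-head {[]}    xs≢[] = ⊥-elim (xs≢[] refl)
  []=-head {x ∷ _} _     = x , here

  []=-last : ∀ {xs : List A} → ¬ xs ≡ [] → ∃ λ a → xs [ pred (length xs) ]= a
  []=-last {[]}     xs≢[] = ⊥-elim (xs≢[] refl)
  []=-last {x ∷ xs} _     = <length⇒[]= (n<1+n (length xs))

  []=⇒≤pred-length : ∀ {xs : List A} {k a} → xs [ k ]= a → k ≤ pred (length xs)
  []=⇒≤pred-length {x ∷ xs} p = ≤-pred ([]=⇒<length p)

  []=⇒∈ : ∀ {xs : List A} {k a} → xs [ k ]= a → a ∈ xs
  []=⇒∈ here      = here refl
  []=⇒∈ (there p) = there ([]=⇒∈ p)

  All-[]= : ∀ {P : A → Set} {xs : List A} → (∀ {k x} → xs [ k ]= x → P x) → All P xs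
  All-[]= {xs = []}     f = []
  All-[]= {xs = x ∷ xs} f = f here ∷ All-[]= (f ∘′ there)

  module _ {B : Set} (f : A → B) where

    []=-map⁺ : ∀ {xs k a} → xs [ k ]= a → map f xs [ k ]= f a
    []=-map⁺ here      = here
    []=-map⁺ (there p) = there ([]=-map⁺ p)

    []=-map⁻ : ∀ {xs k b} → map f xs [ k ]= b → ∃ λ a → xs [ k ]= a × b ≡ f a
    []=-map⁻ {x ∷ xs} here = x , here , refl
    []=-map⁻ {x ∷ xs} (there p) with []=-map⁻ p
    ... | a , q , e = a , there q , e

≡ᵇ-refl : ∀ j → (j ≡ᵇ j) ≡ true
≡ᵇ-refl zero    = refl
≡ᵇ-refl (suc j) = ≡ᵇ-refl j

≢⇒≡ᵇ-false : ∀ a b → ¬ a ≡ b → (a ≡ᵇ b) ≡ false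
≢⇒≡ᵇ-false zero    zero    a≢b = ⊥-elim (a≢b refl)
≢⇒≡ᵇ-false zero    (suc b) _   = refl
≢⇒≡ᵇ-false (suc a) zero    _   = refl
≢⇒≡ᵇ-false (suc a) (suc b) a≢b = ≢⇒≡ᵇ-false a b (a≢b ∘′ cong suc)

≡ᵇ-true⇒≡ : ∀ a b → (a ≡ᵇ b) ≡ true → a ≡ b
≡ᵇ-true⇒≡ a b e = ≡ᵇ⇒≡ a b (subst T (sym e) _)

if-≡ᵇ-same : ∀ {A : Set} j {x y : A} → (if j ≡ᵇ j then x else y) ≡ x
if-≡ᵇ-same j rewrite ≡ᵇ-refl j = refl

if-≡ᵇ-other : ∀ {A : Set} {j j₀} {x y : A} → ¬ j ≡ j₀ → (if j ≡ᵇ j₀ then x else y) ≡ y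
if-≡ᵇ-other {j = j} {j₀} j≢j₀ rewrite ≢⇒≡ᵇ-false j j₀ j≢j₀ = refl

+1+≡+suc : ∀ t q → (t ℤ.+ + 1) ℤ.+ + q ≡ t ℤ.+ + suc q
+1+≡+suc t q = ℤₚ.+-assoc t (+ 1) (+ q)

∈-colBoxes⁻ : ∀ {t j c r j′ e} → (r , j′ , e) ∈ colBoxes t j c →
  j′ ≡ j × ∃ λ q → c [ q ]= e × r ≡ t ℤ.+ + q
∈-colBoxes⁻ {t} {c = x ∷ c} (here refl) = refl , 0 , here , sym (ℤₚ.+-identityʳ t)
∈-colBoxes⁻ {t} {c = x ∷ c} (there b∈) with ∈-colBoxes⁻ b∈
... | j′≡j , q , c[q] , r≡ = j′≡j , suc q , there c[q] , trans r≡ (+1+≡+suc t q)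

∈-colBoxes⁺ : ∀ {t j c q e} → c [ q ]= e → (t ℤ.+ + q , j , e) ∈ colBoxes t j c
∈-colBoxes⁺ {t} here = here (cong (_, _) (ℤₚ.+-identityʳ t))
∈-colBoxes⁺ {t} {j} {q = suc q} {e} (there c[q]) =
  there (subst (λ r → (r , j , e) ∈ _) (+1+≡+suc t q) (∈-colBoxes⁺ c[q]))

∈-boxesFrom⁻ : ∀ {k ts cs r j e} → (r , j , e) ∈ boxesFrom k ts cs →
  ∃ λ m → ∃ λ c → ∃ λ t → ∃ λ q →
    j ≡ k + m × cs [ m ]= c × ts [ m ]= t × c [ q ]= e × r ≡ t ℤ.+ + q
∈-boxesFrom⁻ {k} {t ∷ ts} {c ∷ cs} b∈ with ∈-++⁻ (colBoxes t k c) b∈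
... | inj₁ b∈c with ∈-colBoxes⁻ b∈c
...   | j≡k , q , c[q] , r≡ = 0 , c , t , q , trans j≡k (sym (+-identityʳ k)) , here , here , c[q] , r≡
∈-boxesFrom⁻ {k} {t ∷ ts} {c ∷ cs} _ | inj₂ b∈cs with ∈-boxesFrom⁻ b∈cs
...   | m , c′ , t′ , q , j≡ , cs[m] , ts[m] , c′[q] , r≡ =
  suc m , c′ , t′ , q , trans j≡ (sym (+-suc k m)) , there cs[m] , there ts[m] , c′[q] , r≡

∈-boxesFrom⁺ : ∀ {k ts cs m c t q e} → cs [ m ]= c → ts [ m ]= t → c [ q ]= e →
  (t ℤ.+ + q , k + m , e) ∈ boxesFrom k ts cs
∈-boxesFrom⁺ {k} {t ∷ ts} {c ∷ cs} here here c[q] =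
  ∈-++⁺ˡ (subst (λ j → (_ , j , _) ∈ colBoxes t k c) (sym (+-identityʳ k)) (∈-colBoxes⁺ c[q]))
∈-boxesFrom⁺ {k} {t ∷ ts} {c ∷ cs} {suc m} {t = t′} {q} {e} (there cs[m]) (there ts[m]) c[q] =
  ∈-++⁺ʳ (colBoxes t k c)
    (subst (λ j → (t′ ℤ.+ + q , j , e) ∈ boxesFrom (suc k) ts cs) (sym (+-suc k m)) (∈-boxesFrom⁺ cs[m] ts[m] c[q]))

∈-boxes⁻ : ∀ {w r j e} → (r , j , e) ∈ boxes w →
  ∃ λ c → ∃ λ t → ∃ λ q → columns w [ j ]= c × tops w [ j ]= t × c [ q ]= e × r ≡ t ℤ.+ + q
∈-boxes⁻ b∈ with ∈-boxesFrom⁻ {0} b∈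
... | m , c , t , q , refl , cs[m] , ts[m] , c[q] , r≡ = c , t , q , cs[m] , ts[m] , c[q] , r≡

∈-boxes⁺ : ∀ {w j c t q e} → columns w [ j ]= c → tops w [ j ]= t → c [ q ]= e →
  (t ℤ.+ + q , j , e) ∈ boxes w
∈-boxes⁺ = ∈-boxesFrom⁺ {0}

modifyAt : {A : Set} → ℕ → (A → A) → List A → List A
modifyAt j       g []       = []
modifyAt zero    g (x ∷ xs) = g x ∷ xs
modifyAt (suc j) g (x ∷ xs) = x ∷ modifyAt j g xs

module _ {A : Set} (g : A → A) where

  All-modifyAt : ∀ {P : A → Set} {xs j x} → All P xs → xs [ j ]= x → P (g x) → All P (modifyAt j g xs)
  All-modifyAt (_ ∷ ps) here          q = q ∷ ps
  All-modifyAt (p ∷ ps) (there xs[j]) q = p ∷ All-modifyAt ps xs[j] q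

  []=-modifyAt : ∀ {xs j x} → xs [ j ]= x → modifyAt j g xs [ j ]= g x
  []=-modifyAt here          = here
  []=-modifyAt (there xs[j]) = there ([]=-modifyAt xs[j])

  []=-modifyAt-other : ∀ {xs : List A} {j k x} → modifyAt j g xs [ k ]= x → ¬ k ≡ j → xs [ k ]= x
  []=-modifyAt-other {_ ∷ _} {zero}  here          k≢j = ⊥-elim (k≢j refl)
  []=-modifyAt-other {_ ∷ _} {zero}  (there xs[k]) _   = there xs[k]
  []=-modifyAt-other {_ ∷ _} {suc j} here          _   = here
  []=-modifyAt-other {_ ∷ _} {suc j} (there xs[k]) k≢j = there ([]=-modifyAt-other xs[k] (k≢j ∘′ cong suc))

columns-modifyCol : ∀ j g w → columns (modifyCol j g w) ≡ modifyAt j g (columns w)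
columns-modifyCol zero    g (mkSCol c rs) = refl
columns-modifyCol (suc j) g (mkSCol c rs) = cong (c ∷_) (go j rs)
  where
  go : ∀ j rs → map proj₂ (modifyRest j g rs) ≡ modifyAt j g (map proj₂ rs)
  go j       []        = refl
  go zero    (pc ∷ rs) = refl
  go (suc j) (pc ∷ rs) = cong (proj₂ pc ∷_) (go j rs)

tops-modifyCol : ∀ j (h : ℕ → ℕ) w → tops (modifyCol j (map h) w) ≡ tops w
tops-modifyCol zero    h (mkSCol c rs) = refl
tops-modifyCol (suc j) h (mkSCol c rs) = cong (+ 0 ∷_) (go j (+ 0) rs)
  where
  go : ∀ j t rs → topsFrom t (modifyRest j (map h) rs) ≡ topsFrom t rs
  go j       t []             = refl
  go zero    t ((p , c) ∷ rs) rewrite length-map h c = refl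
  go (suc j) t ((p , c) ∷ rs) = cong (_ ∷_) (go j _ rs)

modifyCol-∘ : ∀ j g h w → modifyCol j g (modifyCol j h w) ≡ modifyCol j (g ∘′ h) w
modifyCol-∘ zero    g h w             = refl
modifyCol-∘ (suc j) g h (mkSCol c rs) = cong (mkSCol c) (go j rs)
  where
  go : ∀ j rs → modifyRest j g (modifyRest j h rs) ≡ modifyRest j (g ∘′ h) rs
  go j       []        = refl
  go zero    (pc ∷ rs) = refl
  go (suc j) (pc ∷ rs) = cong (pc ∷_) (go j rs)

modifyCol-id : ∀ j g w c → columns w [ j ]= c → g c ≡ c → modifyCol j g w ≡ w
modifyCol-id zero    g (mkSCol c rs) c  here         gc≡c = cong (λ c → mkSCol c rs) gc≡c
modifyCol-id (suc j) g (mkSCol c rs) c′ (there w[j]) gc≡c = cong (mkSCol c) (go j rs w[j])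
  where
  go : ∀ j rs → map proj₂ rs [ j ]= c′ → modifyRest j g rs ≡ rs
  go zero    ((p , c) ∷ rs) here          = cong (λ c → (p , c) ∷ rs) gc≡c
  go (suc j) (pc ∷ rs)      (there rs[j]) = cong (pc ∷_) (go j rs rs[j])

relabelAt : ℕ → (ℕ → ℕ) → Box → Box
relabelAt j₀ h (r , j , e) = r , j , (if j ≡ᵇ j₀ then h e else e)

private
  colBoxes-relabel-same : ∀ h t j c → colBoxes t j (map h c) ≡ map (relabelAt j h) (colBoxes t j c)
  colBoxes-relabel-same h t j []      = refl
  colBoxes-relabel-same h t j (x ∷ c) rewrite ≡ᵇ-refl j = cong (_ ∷_) (colBoxes-relabel-same h _ j c)

  colBoxes-relabel-other : ∀ h t j j₀ c → (j ≡ᵇ j₀) ≡ false → colBoxes t j c ≡ map (relabelAt j₀ h) (colBoxes t j c)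
  colBoxes-relabel-other h t j j₀ []      _   = refl
  colBoxes-relabel-other h t j j₀ (x ∷ c) j≢j₀ rewrite j≢j₀ = cong (_ ∷_) (colBoxes-relabel-other h _ j j₀ c j≢j₀)

  boxesFrom-relabel-other : ∀ h j₀ k ts cs → j₀ < k → boxesFrom k ts cs ≡ map (relabelAt j₀ h) (boxesFrom k ts cs)
  boxesFrom-relabel-other h j₀ k (t ∷ ts) (c ∷ cs) j₀<k =
    trans (cong₂ _++_ (colBoxes-relabel-other h t k j₀ c (≢⇒≡ᵇ-false k j₀ (>⇒≢ j₀<k)))
                      (boxesFrom-relabel-other h j₀ (suc k) ts cs (m<n⇒m<1+n j₀<k)))
          (sym (map-++ (relabelAt j₀ h) (colBoxes t k c) _))
  boxesFrom-relabel-other h j₀ k []       cs       _ = refl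
  boxesFrom-relabel-other h j₀ k (t ∷ ts) []       _ = refl

  boxesFrom-modifyAt : ∀ h k ts cs m →
    boxesFrom k ts (modifyAt m (map h) cs) ≡ map (relabelAt (k + m) h) (boxesFrom k ts cs)
  boxesFrom-modifyAt h k []       cs       m = refl
  boxesFrom-modifyAt h k (t ∷ ts) []       m = refl
  boxesFrom-modifyAt h k (t ∷ ts) (c ∷ cs) zero rewrite +-identityʳ k =
    trans (cong₂ _++_ (colBoxes-relabel-same h t k c) (boxesFrom-relabel-other h k (suc k) ts cs (n<1+n k)))
          (sym (map-++ (relabelAt k h) (colBoxes t k c) _))
  boxesFrom-modifyAt h k (t ∷ ts) (c ∷ cs) (suc m) rewrite +-suc k m =
    trans (cong₂ _++_ (colBoxes-relabel-other h t k (suc (k + m)) c (≢⇒≡ᵇ-false k _ (m≢1+m+n k)))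
                      (boxesFrom-modifyAt h (suc k) ts cs m))
          (sym (map-++ (relabelAt (suc (k + m)) h) (colBoxes t k c) _))

boxes-modifyCol : ∀ j h w → boxes (modifyCol j (map h) w) ≡ map (relabelAt j h) (boxes w)
boxes-modifyCol j h w =
  trans (cong₂ (boxesFrom 0) (tops-modifyCol j h w) (columns-modifyCol j (map h) w))
        (boxesFrom-modifyAt h 0 (tops w) (columns w) j)

∈-boxes-modifyCol⁻ : ∀ {j₀ h w r j e} → (r , j , e) ∈ boxes (modifyCol j₀ (map h) w) →
  ∃ λ e₀ → (r , j , e₀) ∈ boxes w × e ≡ (if j ≡ᵇ j₀ then h e₀ else e₀)
∈-boxes-modifyCol⁻ {j₀} {h} {w} b∈ with ∈-map⁻ (relabelAt j₀ h) (subst (_ ∈_) (boxes-modifyCol j₀ h w) b∈)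
... | (_ , _ , e₀) , b₀∈ , refl = e₀ , b₀∈ , refl

∈-boxes-modifyCol⁺ : ∀ {j₀ h w r j e} → (r , j , e) ∈ boxes w →
  (r , j , (if j ≡ᵇ j₀ then h e else e)) ∈ boxes (modifyCol j₀ (map h) w)
∈-boxes-modifyCol⁺ {j₀} {h} {w} b∈ = subst (_ ∈_) (sym (boxes-modifyCol j₀ h w)) (∈-map⁺ (relabelAt j₀ h) b∈)

lengths : SCol → List ℕ
lengths w = map length (columns w)

gluing : SCol → List ℤ
gluing w = map proj₁ (rest w)

lengths-modifyCol : ∀ j h w → lengths (modifyCol j (map h) w) ≡ lengths w
lengths-modifyCol j h w = trans (cong (map length) (columns-modifyCol j (map h) w)) (go j (columns w))
  where
  go : ∀ j cs → map length (modifyAt j (map h) cs) ≡ map length cs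
  go j       []       = refl
  go zero    (c ∷ cs) = cong (_∷ _) (length-map h c)
  go (suc j) (c ∷ cs) = cong (length c ∷_) (go j cs)

gluing-modifyCol : ∀ j g w → gluing (modifyCol j g w) ≡ gluing w
gluing-modifyCol zero    g w             = refl
gluing-modifyCol (suc j) g (mkSCol c rs) = go j rs
  where
  go : ∀ j rs → map proj₁ (modifyRest j g rs) ≡ map proj₁ rs
  go j       []        = refl
  go zero    (pc ∷ rs) = refl
  go (suc j) (pc ∷ rs) = cong (proj₁ pc ∷_) (go j rs)

count : ℤ → List ℤ → ℕ
count x rows = length (filter (ℤ._≟ x) rows)

shapeOfRows : List ℤ → List ℕ
shapeOfRows []       = []
shapeOfRows (r ∷ rs) = map (λ k → count (foldr ℤ._⊓_ r rs ℤ.+ + k) (r ∷ rs))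
                           (upTo (suc ℤ.∣ foldr ℤ._⊔_ r rs ℤ.- foldr ℤ._⊓_ r rs ∣))

shape≡shapeOfRows : ∀ w → shape w ≡ shapeOfRows (map proj₁ (boxes w))
shape≡shapeOfRows w with map proj₁ (boxes w) in eq
... | []     = refl
... | r ∷ rs = map-cong (λ k → trans (countRow≡count _ (boxes w)) (cong (count _) eq)) _
  where
  countRow≡count : ∀ x bs → countRow x bs ≡ count x (map proj₁ bs)
  countRow≡count x []       = refl
  countRow≡count x (b ∷ bs) with does (proj₁ b ℤ.≟ x)
  ... | true  = cong suc (countRow≡count x bs)
  ... | false = countRow≡count x bs

shape-cong-rows : ∀ v w → map proj₁ (boxes v) ≡ map proj₁ (boxes w) → shape v ≡ shape w
shape-cong-rows v w rows≡ = trans (shape≡shapeOfRows v) (trans (cong shapeOfRows rows≡) (sym (shape≡shapeOfRows w)))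

shape-modifyCol : ∀ j h w → shape (modifyCol j (map h) w) ≡ shape w
shape-modifyCol j h w = shape-cong-rows (modifyCol j (map h) w) w
  (trans (cong (map proj₁) (boxes-modifyCol j h w)) (sym (map-∘ {g = proj₁} {f = relabelAt j h} (boxes w))))

AllSigns : Sign → List (ℕ × Sign) → Set
AllSigns s = All ((_≡ s) ∘ proj₂)

pushIndices : List (ℕ × Sign) → List ℕ → List ℕ
pushIndices []            acc = acc
pushIndices ((j , _) ∷ s) acc = pushIndices s (j ∷ acc)

reduce-plus-++ : ∀ A B ps → AllSigns plus A → reduce (A ++ B) ps [] ≡ reduce B (pushIndices A ps) []
reduce-plus-++ []            B ps []          = refl
reduce-plus-++ ((j , _) ∷ A) B ps (refl ∷ A⁺) = reduce-plus-++ A B (j ∷ ps) A⁺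

reduce-minus : ∀ B ps ms → AllSigns minus B → reduce B ps ms ≡ (ps , pushIndices B ms)
reduce-minus []            ps ms []          = refl
reduce-minus ((j , _) ∷ B) ps ms (refl ∷ B⁻) = reduce-minus B ps (j ∷ ms) B⁻

last-pushIndices : ∀ B x acc → last (pushIndices B (x ∷ acc)) ≡ last (x ∷ acc)
last-pushIndices []            x acc = refl
last-pushIndices ((j , _) ∷ B) x acc = last-pushIndices B j (x ∷ acc)

-- In a word +…+ s −…− the letter s is unmatched: it is the leftmost unmatched − or the
-- rightmost unmatched +.
leftmost-minus : ∀ A B j → AllSigns plus A → AllSigns minus B →
  last (proj₂ (reduce (A ++ (j , minus) ∷ B) [] [])) ≡ just j
leftmost-minus A B j A⁺ B⁻
  rewrite reduce-plus-++ A ((j , minus) ∷ B) [] A⁺ | reduce-minus B (pushIndices A []) (j ∷ []) B⁻ =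
  last-pushIndices B j []

rightmost-plus : ∀ A B j → AllSigns plus A → AllSigns minus B →
  head (proj₁ (reduce (A ++ (j , plus) ∷ B) [] [])) ≡ just j
rightmost-plus A B j A⁺ B⁻
  rewrite reduce-plus-++ A ((j , plus) ∷ B) [] A⁺ | reduce-minus B (j ∷ pushIndices A []) [] B⁻ = refl

PlusOrNone MinusOrNone : ℕ → Col → Set
PlusOrNone  i c = All (_≡ plus)  (signOf i c)
MinusOrNone i c = All (_≡ minus) (signOf i c)

plusOrNone : ∀ i c → (mem (suc i) c ≡ true → mem i c ≡ true) → PlusOrNone i c
plusOrNone i c h with mem i c | mem (suc i) c
... | true  | false = refl ∷ []
... | true  | true  = []
... | false | false = []
... | false | true with h refl
...   | ()

minusOrNone : ∀ i c → (mem i c ≡ true → mem (suc i) c ≡ true) → MinusOrNone i c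
minusOrNone i c h with mem i c | mem (suc i) c
... | false | true  = refl ∷ []
... | true  | true  = []
... | false | false = []
... | true  | false with h refl
...   | ()

signOf-minus : ∀ i c → mem i c ≡ false → mem (suc i) c ≡ true → signOf i c ≡ minus ∷ []
signOf-minus i c i∉ i+1∈ rewrite i∉ | i+1∈ = refl

signOf-plus : ∀ i c → mem i c ≡ true → mem (suc i) c ≡ false → signOf i c ≡ plus ∷ []
signOf-plus i c i∈ i+1∉ rewrite i∈ | i+1∉ = refl

minus∈signOf : ∀ i c → minus ∈ signOf i c → mem i c ≡ false × mem (suc i) c ≡ true
minus∈signOf i c m with mem i c | mem (suc i) c
minus∈signOf i c (here ()) | true  | false
minus∈signOf i c _         | false | true  = refl , refl

signWordFrom-all : ∀ {s} i k cs → (∀ {j c} → cs [ j ]= c → All (_≡ s) (signOf i c)) →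
  AllSigns s (signWordFrom i k cs)
signWordFrom-all i k []       h = []
signWordFrom-all i k (c ∷ cs) h = ++⁺ (map⁺ (h here)) (signWordFrom-all i (suc k) cs (h ∘ there))

SignsAround : ℕ → List Col → ℕ → Set
SignsAround i cs j₀ = (∀ {j c} → j < j₀ → cs [ j ]= c → PlusOrNone i c)
                    × (∀ {j c} → j₀ < j → cs [ j ]= c → MinusOrNone i c)

signWordFrom-split : ∀ i s k cs j₀ c₀ → cs [ j₀ ]= c₀ → signOf i c₀ ≡ s ∷ [] → SignsAround i cs j₀ →
  ∃₂ λ A B → signWordFrom i k cs ≡ A ++ (k + j₀ , s) ∷ B × AllSigns plus A × AllSigns minus B
signWordFrom-split i s k (c₀ ∷ cs) zero c₀ here sign (_ , right) rewrite sign | +-identityʳ k =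
  [] , _ , refl , [] , signWordFrom-all i (suc k) cs (right (s≤s z≤n) ∘ there)
signWordFrom-split i s k (c ∷ cs) (suc j₀) c₀ (there cs[j₀]) sign (left , right)
  with signWordFrom-split i s (suc k) cs j₀ c₀ cs[j₀] sign
         ((λ j<j₀ → left (s≤s j<j₀) ∘ there) , (λ j₀<j → right (s≤s j₀<j) ∘ there))
... | A , B , split , A⁺ , B⁻ =
  signs c ++ A , B ,
  trans (cong (signs c ++_) split)
    (trans (sym (++-assoc (signs c) A _))
           (cong (λ j → (signs c ++ A) ++ (j , s) ∷ B) (sym (+-suc k j₀)))) ,
  ++⁺ (map⁺ (left (s≤s z≤n) here)) A⁺ , B⁻
  where
  signs : Col → List (ℕ × Sign)
  signs c = map (k ,_) (signOf i c)

eCand-isolated : ∀ {i w j₀ c₀} → columns w [ j₀ ]= c₀ → signOf i c₀ ≡ minus ∷ [] →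
  SignsAround i (columns w) j₀ → eCand i w ≡ just (modifyCol j₀ (replaceEntry (suc i) i) w)
eCand-isolated {i} {w} {j₀} {c₀} w[j₀] sign around
  with signWordFrom-split i minus 0 (columns w) j₀ c₀ w[j₀] sign around
... | A , B , split , A⁺ , B⁻ rewrite split | leftmost-minus A B j₀ A⁺ B⁻ = refl

fCand-isolated : ∀ {i w j₀ c₀} → columns w [ j₀ ]= c₀ → signOf i c₀ ≡ plus ∷ [] →
  SignsAround i (columns w) j₀ → fCand i w ≡ just (modifyCol j₀ (replaceEntry i (suc i)) w)
fCand-isolated {i} {w} {j₀} {c₀} w[j₀] sign around
  with signWordFrom-split i plus 0 (columns w) j₀ c₀ w[j₀] sign around
... | A , B , split , A⁺ , B⁻ rewrite split | rightmost-plus A B j₀ A⁺ B⁻ = refl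

fCand⇒modifyCol : ∀ i w d → fCand i w ≡ just d → ∃ λ j → d ≡ modifyCol j (replaceEntry i (suc i)) w
fCand⇒modifyCol i w d fc with head (proj₁ (remaining i w))
fCand⇒modifyCol i w d refl | just j = j , refl

last-∈ : ∀ {xs : List ℕ} {j} → last xs ≡ just j → j ∈ xs
last-∈ {x ∷ []}     refl = here refl
last-∈ {x ∷ y ∷ xs} e    = there (last-∈ {y ∷ xs} e)

∈-reduce-minus : ∀ s ps ms {j} → j ∈ proj₂ (reduce s ps ms) → j ∈ ms ⊎ (j , minus) ∈ s
∈-reduce-minus []               ps ms       j∈ = inj₁ j∈
∈-reduce-minus ((k , plus) ∷ s) ps []       j∈ with ∈-reduce-minus s (k ∷ ps) [] j∈
... | inj₂ j∈s = inj₂ (there j∈s)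
∈-reduce-minus ((k , plus) ∷ s) ps (m ∷ ms) j∈ with ∈-reduce-minus s ps ms j∈
... | inj₁ j∈ms = inj₁ (there j∈ms)
... | inj₂ j∈s  = inj₂ (there j∈s)
∈-reduce-minus ((k , minus) ∷ s) ps ms j∈ with ∈-reduce-minus s ps (k ∷ ms) j∈
... | inj₁ (here refl)  = inj₂ (here refl)
... | inj₁ (there j∈ms) = inj₁ j∈ms
... | inj₂ j∈s          = inj₂ (there j∈s)

minus∈signWordFrom : ∀ i k cs {j} → (j , minus) ∈ signWordFrom i k cs →
  ∃₂ λ m c → j ≡ k + m × cs [ m ]= c × mem i c ≡ false × mem (suc i) c ≡ true
minus∈signWordFrom i k (c ∷ cs) j∈ with ∈-++⁻ (map (k ,_) (signOf i c)) j∈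
... | inj₁ j∈c with ∈-map⁻ (k ,_) j∈c
...   | _ , m∈ , refl = 0 , c , sym (+-identityʳ k) , here , minus∈signOf i c m∈
minus∈signWordFrom i k (c ∷ cs) j∈ | inj₂ j∈cs with minus∈signWordFrom i (suc k) cs j∈cs
...   | m , c′ , j≡ , cs[m] , signs = suc m , c′ , trans j≡ (sym (+-suc k m)) , there cs[m] , signs

eCand⇒modifyCol : ∀ i w d → eCand i w ≡ just d →
  ∃₂ λ j c → d ≡ modifyCol j (replaceEntry (suc i) i) w × columns w [ j ]= c
           × mem i c ≡ false × mem (suc i) c ≡ true
eCand⇒modifyCol i w d ec with last (proj₂ (remaining i w)) in lastEq
... | just j with ec | ∈-reduce-minus (signWord i w) [] [] (last-∈ lastEq)
...   | refl | inj₂ j∈ with minus∈signWordFrom i 0 (columns w) j∈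
...     | m , c , refl , w[m] , i∉ , i+1∈ = m , c , refl , w[m] , i∉ , i+1∈

[]=⇒mem : ∀ {c q x} → c [ q ]= x → mem x c ≡ true
[]=⇒mem {x = x} here rewrite ≡ᵇ-refl x = refl
[]=⇒mem {a ∷ c} (there c[q]) rewrite []=⇒mem c[q] = ∨-zeroʳ _

mem⇒[]= : ∀ x c → mem x c ≡ true → ∃ λ q → c [ q ]= x
mem⇒[]= x (a ∷ c) x∈ with a ≡ᵇ x in a≡x
... | true rewrite ≡ᵇ-true⇒≡ a x a≡x = 0 , here
... | false with mem⇒[]= x c x∈
...   | q , c[q] = suc q , there c[q]

mem-∷-false : ∀ x a c → mem x (a ∷ c) ≡ false → ¬ a ≡ x × mem x c ≡ false
mem-∷-false x a c x∉ with a ≡ᵇ x in a≡ᵇx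
... | false = (λ { refl → true≢false (trans (sym (≡ᵇ-refl x)) a≡ᵇx) }) , x∉
  where
  true≢false : ¬ true ≡ false
  true≢false ()

replace : ℕ → ℕ → ℕ → ℕ
replace a b x = if x ≡ᵇ a then b else x

lower raise : ℕ → ℕ → ℕ
lower i = replace (suc i) i
raise i = replace i (suc i)

replace-same : ∀ a b → replace a b a ≡ b
replace-same a b rewrite ≡ᵇ-refl a = refl

lower-≤ : ∀ i x → lower i x ≤ x
lower-≤ i x with x ≡ᵇ suc i in x≡
... | true rewrite ≡ᵇ-true⇒≡ x (suc i) x≡ = n≤1+n i
... | false = ≤-refl

lower-<-mono : ∀ i a b → a < b → ¬ a ≡ i → ¬ b ≡ i → lower i a < lower i b
lower-<-mono i a b a<b a≢i b≢i with a ≡ᵇ suc i in a≡ | b ≡ᵇ suc i in b≡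
... | true  | true  = ⊥-elim (<-irrefl (trans (≡ᵇ-true⇒≡ a _ a≡) (sym (≡ᵇ-true⇒≡ b _ b≡))) a<b)
... | true  | false rewrite ≡ᵇ-true⇒≡ a _ a≡ = <-trans (n<1+n i) a<b
... | false | true  rewrite ≡ᵇ-true⇒≡ b _ b≡ = ≤∧≢⇒< (≤-pred a<b) a≢i
... | false | false = a<b

ValidCol-lower : ∀ n i c → 1 ≤ i → i ≤ n → mem i c ≡ false → ValidCol n c → ValidCol n (map (lower i) c)
ValidCol-lower n i []      _   _   _  (c≢[] , _) = ⊥-elim (c≢[] refl)
ValidCol-lower n i (a ∷ c) 1≤i i≤n i∉ (_ , increasing , bounded) =
  (λ ()) , increasing-lower (a ∷ c) i∉ increasing , bounded-lower (a ∷ c) bounded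
  where
  increasing-lower : ∀ c → mem i c ≡ false → Linked _<_ c → Linked _<_ (map (lower i) c)
  increasing-lower []          _  []  = []
  increasing-lower (a ∷ [])    _  [-] = [-]
  increasing-lower (a ∷ b ∷ c) i∉ (a<b ∷ l) with mem-∷-false i a (b ∷ c) i∉
  ... | a≢i , i∉′ with mem-∷-false i b c i∉′
  ...   | b≢i , _ = lower-<-mono i a b a<b a≢i b≢i ∷ increasing-lower (b ∷ c) i∉′ l

  bounded-lower : ∀ c → All (λ x → 1 ≤ x × x ≤ n) c → All (λ x → 1 ≤ x × x ≤ n) (map (lower i) c)
  bounded-lower []      []       = []
  bounded-lower (a ∷ c) (b ∷ bs) with a ≡ᵇ suc i
  ... | true  = (1≤i , i≤n) ∷ bounded-lower c bs
  ... | false = b ∷ bounded-lower c bs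

raise∘lower : ∀ i c → mem i c ≡ false → map (raise i) (map (lower i) c) ≡ c
raise∘lower i []      _  = refl
raise∘lower i (a ∷ c) i∉ with mem-∷-false i a c i∉
... | a≢i , i∉′ = cong₂ _∷_ (pointwise a a≢i) (raise∘lower i c i∉′)
  where
  pointwise : ∀ a → ¬ a ≡ i → raise i (lower i a) ≡ a
  pointwise a a≢i with a ≡ᵇ suc i in a≡
  ... | true rewrite ≡ᵇ-refl i = sym (≡ᵇ-true⇒≡ a _ a≡)
  ... | false rewrite ≢⇒≡ᵇ-false a i a≢i = refl

suc∉lower : ∀ i c → mem (suc i) (map (lower i) c) ≡ false
suc∉lower i []      = refl
suc∉lower i (a ∷ c) with a ≡ᵇ suc i in a≡
... | true rewrite ≢⇒≡ᵇ-false i (suc i) (<⇒≢ (n<1+n i)) = suc∉lower i c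
... | false rewrite a≡ = suc∉lower i c

∈lower : ∀ i c → mem (suc i) c ≡ true → mem i (map (lower i) c) ≡ true
∈lower i c i+1∈ with mem⇒[]= (suc i) c i+1∈
... | q , c[q] = []=⇒mem (subst (map (lower i) c [ q ]=_) (replace-same (suc i) i) ([]=-map⁺ (lower i) c[q]))

sum-lower-< : ∀ i c q → c [ q ]= suc i → sum (map (lower i) c) < sum c
sum-lower-< i (a ∷ c) zero here rewrite replace-same (suc i) i = s≤s (+-monoʳ-≤ i (sum-lower-≤ c))
  where
  sum-lower-≤ : ∀ c → sum (map (lower i) c) ≤ sum c
  sum-lower-≤ []      = z≤n
  sum-lower-≤ (a ∷ c) = +-mono-≤ (lower-≤ i a) (sum-lower-≤ c)
sum-lower-< i (a ∷ c) (suc q) (there c[q]) = +-mono-≤-< (lower-≤ i a) (sum-lower-< i c q c[q])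

≤-lower : ∀ i {a b} → a ≤ b → (b ≡ suc i → ¬ a ≡ suc i) → a ≤ lower i b
≤-lower i {a} {b} a≤b b≡→a≢ with b ≡ᵇ suc i in b≡
... | false = a≤b
... | true with ≡ᵇ-true⇒≡ b _ b≡
...   | refl = ≤-pred (≤∧≢⇒< a≤b (b≡→a≢ refl))

entrySum : SCol → ℕ
entrySum w = sum (map sum (columns w))

sum-modifyAt-< : ∀ (g : Col → Col) cs j c → cs [ j ]= c → sum (g c) < sum c →
  sum (map sum (modifyAt j g cs)) < sum (map sum cs)
sum-modifyAt-< g (c ∷ cs) zero    c here          gc<c = +-monoˡ-< _ gc<c
sum-modifyAt-< g (c ∷ cs) (suc j) c′ (there cs[j]) gc<c = +-monoʳ-< (sum c) (sum-modifyAt-< g cs j c′ cs[j] gc<c)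

record LoweringSite (n i : ℕ) (v : SCol) : Set where
  field
    col           : ℕ
    column        : Col
    column-at     : columns v [ col ]= column
    i∉            : mem i column ≡ false
    suc-i∈        : mem (suc i) column ≡ true
    signsAround   : SignsAround i (columns v) col
    unique-in-row : ∀ {r j} → j < col → (r , j , suc i) ∈ boxes v → ¬ (r , col , suc i) ∈ boxes v

module Lowering {n i v} (v∈ : InScol n v) (1≤i : 1 ≤ i) (i<n : i < n) (site : LoweringSite n i v) where
  open LoweringSite site

  lowered : SCol
  lowered = modifyCol col (replaceEntry (suc i) i) v

  columns-lowered : columns lowered ≡ modifyAt col (map (lower i)) (columns v)
  columns-lowered = columns-modifyCol col (map (lower i)) v

  private
    valid : All (ValidCol n) (columns lowered)
    valid = subst (All (ValidCol n)) (sym columns-lowered)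
      (All-modifyAt (map (lower i)) (proj₁ v∈) column-at
         (ValidCol-lower n i column 1≤i (<⇒≤ i<n) i∉ (All.lookup (proj₁ v∈) ([]=⇒∈ column-at))))

    rowConnected : RowConnected lowered
    rowConnected b₁ b₂ j<k k<j′ with ∈-boxes-modifyCol⁻ {col} {lower i} {v} b₁ | ∈-boxes-modifyCol⁻ {col} {lower i} {v} b₂
    ... | _ , b₁∈v , _ | _ , b₂∈v , _ with proj₁ (proj₂ v∈) b₁∈v b₂∈v j<k k<j′
    ...   | _ , b∈v = _ , ∈-boxes-modifyCol⁺ {col} {lower i} {v} b∈v

    rowIncreasing : RowIncreasing lowered
    rowIncreasing {r} {j} {j′} b₁ b₂ j<j′ with ∈-boxes-modifyCol⁻ {col} {lower i} {v} b₁ | ∈-boxes-modifyCol⁻ {col} {lower i} {v} b₂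
    ... | a , a∈ , refl | b , b∈ , refl with proj₂ (proj₂ v∈) a∈ b∈ j<j′ | j ≟ col | j′ ≟ col
    ... | _   | yes refl | yes refl = ⊥-elim (<-irrefl refl j<j′)
    ... | a≤b | yes refl | no j′≢ rewrite ≡ᵇ-refl col | ≢⇒≡ᵇ-false j′ col j′≢ =
      ≤-trans (lower-≤ i a) a≤b
    ... | a≤b | no j≢ | no j′≢ rewrite ≢⇒≡ᵇ-false j col j≢ | ≢⇒≡ᵇ-false j′ col j′≢ = a≤b
    ... | a≤b | no j≢ | yes refl rewrite ≢⇒≡ᵇ-false j col j≢ | ≡ᵇ-refl col =
      ≤-lower i a≤b λ { refl refl → unique-in-row j<j′ a∈ b∈ }

  lowered∈ : InScol n lowered
  lowered∈ = valid , rowConnected , rowIncreasing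

  eStep : EStep n i v lowered
  eStep = eCand-isolated column-at (signOf-minus i column i∉ suc-i∈) signsAround , lowered∈

  fStep : FStep n i lowered v
  fStep = trans (fCand-isolated lowered[col] (signOf-plus i (map (lower i) column) (∈lower i column suc-i∈) (suc∉lower i column)) around)
                (cong just (trans (modifyCol-∘ col (map (raise i)) (map (lower i)) v)
                                  (modifyCol-id col _ v column column-at (raise∘lower i column i∉))))
        , v∈
    where
    lowered[col] : columns lowered [ col ]= map (lower i) column
    lowered[col] = subst (_[ col ]= _) (sym columns-lowered) ([]=-modifyAt (map (lower i)) column-at)
    unmodified : ∀ {j c} → ¬ j ≡ col → columns lowered [ j ]= c → columns v [ j ]= c
    unmodified j≢ p = []=-modifyAt-other (map (lower i)) (subst (_[ _ ]= _) columns-lowered p) j≢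
    around : SignsAround i (columns lowered) col
    around = (λ j<col → proj₁ signsAround j<col ∘ unmodified (<⇒≢ j<col))
           , (λ col<j → proj₂ signsAround col<j ∘ unmodified (>⇒≢ col<j))

  entrySum-lowered : entrySum lowered < entrySum v
  entrySum-lowered with mem⇒[]= (suc i) column suc-i∈
  ... | q , column[q] = subst (λ cs → sum (map sum cs) < entrySum v) (sym columns-lowered)
                          (sum-modifyAt-< (map (lower i)) (columns v) col column column-at (sum-lower-< i column q column[q]))

column-< : ∀ {c q q′ a b} → Linked _<_ c → c [ q ]= a → c [ q′ ]= b → q < q′ → a < b
column-< (a<b ∷ _) here      (there here)      _          = a<b
column-< (a<b ∷ l) here      (there (there p)) _          = <-trans a<b (column-< l here (there p) (s≤s z≤n))
column-< (_ ∷ l)   (there p) (there p′)        (s≤s q<q′) = column-< l p p′ q<q′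

column-≤ : ∀ {c q q′ a b} → Linked _<_ c → c [ q ]= a → c [ q′ ]= b → q ≤ q′ → a ≤ b
column-≤ l p p′ q≤q′ with m≤n⇒m<n∨m≡n q≤q′
... | inj₁ q<q′ = <⇒≤ (column-< l p p′ q<q′)
... | inj₂ refl = ≤-reflexive ([]=-functional p p′)

column-injective : ∀ {c q q′ a} → Linked _<_ c → c [ q ]= a → c [ q′ ]= a → q ≡ q′
column-injective {q = q} {q′} l p p′ with <-cmp q q′
... | tri< q<q′ _ _ = ⊥-elim (<-irrefl refl (column-< l p p′ q<q′))
... | tri≈ _ q≡q′ _ = q≡q′
... | tri> _ _ q>q′ = ⊥-elim (<-irrefl refl (column-< l p′ p q>q′))

head+index≤ : ∀ {a c q e} → Linked _<_ (a ∷ c) → (a ∷ c) [ q ]= e → a + q ≤ e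
head+index≤ {a} _ here = ≤-reflexive (+-identityʳ a)
head+index≤ {a} {b ∷ c} {suc q} (a<b ∷ l) (there p) =
  ≤-trans (≤-reflexive (+-suc a q)) (≤-trans (+-monoˡ-≤ q a<b) (head+index≤ l p))

index<entry : ∀ {n c q e} → ValidCol n c → c [ q ]= e → suc q ≤ e
index<entry {c = a ∷ c} (_ , l , (1≤a , _) ∷ _) p = ≤-trans (+-monoˡ-≤ _ 1≤a) (head+index≤ l p)

-- The entry above x + 1 is less than x + 1 and at least x.
pred-entry∈ : ∀ {c x} → Linked _<_ c → (∀ {q e} → c [ q ]= e → suc q ≤ e) → c [ x ]= suc x → 1 ≤ x → mem x c ≡ true
pred-entry∈ {c} {suc x} increasing index< c[x+1] _ with []=-downward c[x+1] (n≤1+n x)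
... | e , c[x] = []=⇒mem (subst (c [ x ]=_) (≤-antisym (≤-pred (column-< increasing c[x] c[x+1] (n<1+n x))) (index< c[x])) c[x])

column-bounds : ∀ {n c q e} → ValidCol n c → c [ q ]= e → 1 ≤ e × e ≤ n
column-bounds (_ , _ , bounds) p = All.lookup bounds ([]=⇒∈ p)

validCol : ∀ {n v j c} → InScol n v → columns v [ j ]= c → ValidCol n c
validCol v∈ v[j] = All.lookup (proj₁ v∈) ([]=⇒∈ v[j])

lengths-positive : ∀ {n cs} → All (ValidCol n) cs → All (1 ≤_) (map length cs)
lengths-positive []                          = []
lengths-positive {cs = []      ∷ _} ((c≢[] , _) ∷ _) = ⊥-elim (c≢[] refl)
lengths-positive {cs = (_ ∷ _) ∷ _} (_ ∷ valid)      = s≤s z≤n ∷ lengths-positive valid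

module _ {v Ts} (tops≡ : tops v ≡ map +_ Ts) where

  ∈-boxes-natural⁻ : ∀ {r j e} → (+ r , j , e) ∈ boxes v →
    ∃₂ λ c T → ∃ λ q → columns v [ j ]= c × Ts [ j ]= T × c [ q ]= e × r ≡ T + q
  ∈-boxes-natural⁻ {r} {j} b∈ with ∈-boxes⁻ {v} b∈
  ... | c , t , q , v[j] , tops[j] , c[q] , r≡ with []=-map⁻ +_ (subst (_[ j ]= t) tops≡ tops[j])
  ...   | T , Ts[j] , refl = c , T , q , v[j] , Ts[j] , c[q] , ℤₚ.+-injective r≡

  row-natural : ∀ {r j e} → (r , j , e) ∈ boxes v → ∃ λ r′ → r ≡ + r′
  row-natural {j = j} b∈ with ∈-boxes⁻ {v} b∈
  ... | c , t , q , v[j] , tops[j] , c[q] , r≡ with []=-map⁻ +_ (subst (_[ j ]= t) tops≡ tops[j])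
  ...   | T , Ts[j] , refl = T + q , r≡

  ∈-boxes-natural⁺ : ∀ {j c T q e} → columns v [ j ]= c → Ts [ j ]= T → c [ q ]= e →
    (+ (T + q) , j , e) ∈ boxes v
  ∈-boxes-natural⁺ {j} {T = T} v[j] Ts[j] c[q] =
    ∈-boxes⁺ {v} v[j] (subst (_[ j ]= + T) (sym tops≡) ([]=-map⁺ +_ Ts[j])) c[q]

-- Misplaced boxes

-- Rows are numbered from 0, so the entry r + 1 is the smallest one a box in row r can hold.
record RowBounded (v : SCol) : Set where
  field
    topRows   : List ℕ
    tops≡     : tops v ≡ map +_ topRows
    row<entry : ∀ {r j e} → (+ r , j , e) ∈ boxes v → suc r ≤ e

AllPlaced : SCol → Set
AllPlaced v = ∀ {r j e} → (+ r , j , e) ∈ boxes v → e ≡ suc r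

record LeastMisplaced (v : SCol) (Ts : List ℕ) : Set where
  field
    i row col   : ℕ
    1≤i         : 1 ≤ i
    box         : (+ row , col , suc i) ∈ boxes v
    misplaced   : suc row < suc i
    least-entry : ∀ {r j e} → (+ r , j , e) ∈ boxes v → suc r < e → suc i ≤ e
    leftmost    : ∀ {r j} → (+ r , j , suc i) ∈ boxes v → suc r < suc i → col ≤ j
    column      : Col
    top index   : ℕ
    column-at   : columns v [ col ]= column
    top-at      : Ts [ col ]= top
    entry-at    : column [ index ]= suc i
    row≡        : row ≡ top + index

placed-below : ∀ {v} → (rb : RowBounded v) → (m : LeastMisplaced v (RowBounded.topRows rb)) →
  ∀ {r j e} → (+ r , j , e) ∈ boxes v → e < suc (LeastMisplaced.i m) → e ≡ suc r
placed-below rb m b∈ e<i+1 with m≤n⇒m<n∨m≡n (RowBounded.row<entry rb b∈)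
... | inj₂ r+1≡e = sym r+1≡e
... | inj₁ r+1<e = ⊥-elim (<-irrefl refl (<-≤-trans e<i+1 (LeastMisplaced.least-entry m b∈ r+1<e)))

least : ∀ {P : ℕ → Set} → Decidable P → ∀ {a} → P a → ∃ λ m → P m × (∀ {k} → k < m → ¬ P k)
least {P} P? {a} = <-rec (λ a → P a → ∃ λ m → P m × (∀ {k} → k < m → ¬ P k)) step a
  where
  step : ∀ a → (∀ {b} → b < a → P b → ∃ λ m → P m × (∀ {k} → k < m → ¬ P k)) →
         P a → ∃ λ m → P m × (∀ {k} → k < m → ¬ P k)
  step a smaller pa with anyUpTo? P? a
  ... | yes (b , b<a , pb) = smaller b<a pb
  ... | no none            = a , pa , λ k<a pk → none (_ , k<a , pk)

Misplaced : Box → Set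
Misplaced (r , _ , e) = suc ℤ.∣ r ∣ < e

misplaced? : Decidable Misplaced
misplaced? (r , _ , e) = suc ℤ.∣ r ∣ <? e

module _ {v} (rb : RowBounded v) where
  open RowBounded rb

  private
    misplacedEntry? : Decidable λ x → Any (λ b → Misplaced b × proj₂ (proj₂ b) ≡ x) (boxes v)
    misplacedEntry? x = any? (λ b → misplaced? b ×-dec proj₂ (proj₂ b) ≟ x) (boxes v)

    misplacedIn? : ∀ x → Decidable λ j → Any (λ b → Misplaced b × proj₂ (proj₂ b) ≡ x × proj₁ (proj₂ b) ≡ j) (boxes v)
    misplacedIn? x j = any? (λ b → misplaced? b ×-dec (proj₂ (proj₂ b) ≟ x ×-dec proj₁ (proj₂ b) ≟ j)) (boxes v)

  leastMisplaced : Any Misplaced (boxes v) → LeastMisplaced v topRows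
  leastMisplaced some with find some
  ... | b , b∈ , mis with least misplacedEntry? (lose b∈ (mis , refl))
  ...   | x , someˣ , below-x with find someˣ
  ...     | (_ , j , _) , b′∈ , mis′ , refl with least (misplacedIn? x) (lose b′∈ (mis′ , refl , refl))
  ...       | j₀ , someʲ , left-of-j₀ with find someʲ
  ...         | (_ , _ , _) , b₀∈ , mis₀ , refl , refl with row-natural tops≡ b₀∈
  ...           | r₀ , refl with mis₀ | ∈-boxes-natural⁻ tops≡ b₀∈
  ...             | s≤s (s≤s r₀<i) | c , T , q , v[j₀] , Ts[j₀] , c[q] , r₀≡ = record
    { i = _ ; row = r₀ ; col = j₀ ; 1≤i = ≤-trans (s≤s z≤n) (s≤s r₀<i) ; box = b₀∈ ; misplaced = mis₀
    ; least-entry = λ b∈ mis → ≮⇒≥ λ e<x → below-x e<x (lose b∈ (mis , refl))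
    ; leftmost    = λ b∈ mis → ≮⇒≥ λ j<j₀ → left-of-j₀ j<j₀ (lose b∈ (mis , refl , refl))
    ; column = c ; top = T ; index = q ; column-at = v[j₀] ; top-at = Ts[j₀] ; entry-at = c[q] ; row≡ = r₀≡ }

allPlaced⊎leastMisplaced : ∀ v → (rb : RowBounded v) → AllPlaced v ⊎ LeastMisplaced v (RowBounded.topRows rb)
allPlaced⊎leastMisplaced v rb with any? misplaced? (boxes v)
... | yes some = inj₂ (leastMisplaced rb some)
... | no none  = inj₁ λ b∈ → placed b∈ (none ∘ lose b∈)
  where
  placed : ∀ {r j e} → (+ r , j , e) ∈ boxes v → ¬ suc r < e → e ≡ suc r
  placed b∈ ¬r+1<e with m≤n⇒m<n∨m≡n (RowBounded.row<entry rb b∈)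
  ... | inj₁ r+1<e = ⊥-elim (¬r+1<e r+1<e)
  ... | inj₂ r+1≡e = sym r+1≡e

module AtLeastMisplaced {n v} (v∈ : InScol n v) (rb : RowBounded v) (m : LeastMisplaced v (RowBounded.topRows rb)) where
  open RowBounded rb
  open LeastMisplaced m

  private
    increasing : Linked _<_ column
    increasing = proj₁ (proj₂ (validCol v∈ column-at))

  i<n : i < n
  i<n = proj₂ (column-bounds (validCol v∈ column-at) entry-at)

  -- An entry i in this column would be placed, hence in a row below that of i + 1.
  i∉column : mem i column ≡ false
  i∉column with mem i column in i∈
  ... | false = refl
  ... | true with mem⇒[]= i column i∈
  ...   | q , column[q] = ⊥-elim (<-irrefl refl (<-≤-trans (n<1+n i) (column-≤ increasing entry-at column[q] index≤q)))
    where
    i≡ : i ≡ suc (top + q)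
    i≡ = placed-below rb m (∈-boxes-natural⁺ tops≡ column-at top-at column[q]) (n<1+n i)
    index≤q : index ≤ q
    index≤q = +-cancelˡ-≤ top _ _ (≤-pred (subst₂ _<_ row≡ i≡ (≤-pred misplaced)))

  unique-in-row : ∀ {r j} → j < col → (r , j , suc i) ∈ boxes v → ¬ (r , col , suc i) ∈ boxes v
  unique-in-row j<col b∈ b₀∈ with row-natural tops≡ b∈
  ... | r , refl with ∈-boxes-natural⁻ tops≡ b₀∈
  ...   | c , T , q , v[col] , Ts[col] , c[q] , r≡ with []=-functional v[col] column-at | []=-functional Ts[col] top-at
  ...     | refl | refl with column-injective increasing c[q] entry-at
  ...       | refl = <-irrefl refl (<-≤-trans j<col (leftmost (subst (λ r → (+ r , _ , suc i) ∈ boxes v) (trans r≡ (sym row≡)) b∈) misplaced))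

  loweringSite : SignsAround i (columns v) col → LoweringSite n i v
  loweringSite around = record
    { col = col ; column = column ; column-at = column-at ; i∉ = i∉column ; suc-i∈ = []=⇒mem entry-at
    ; signsAround = around ; unique-in-row = unique-in-row }

-- Superstandard tableaux

consecutive : ℕ → ℕ → List ℕ
consecutive T zero    = []
consecutive T (suc l) = suc T ∷ consecutive (suc T) l

length-consecutive : ∀ T l → length (consecutive T l) ≡ l
length-consecutive T zero    = refl
length-consecutive T (suc l) = cong suc (length-consecutive (suc T) l)

[]=-consecutive⁻ : ∀ {T l q e} → consecutive T l [ q ]= e → q < l × e ≡ suc (T + q)
[]=-consecutive⁻ {T} {suc l} here = s≤s z≤n , cong suc (sym (+-identityʳ T))
[]=-consecutive⁻ {T} {suc l} {suc q} (there p) with []=-consecutive⁻ p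
... | q<l , e≡ = s≤s q<l , trans e≡ (cong suc (sym (+-suc T q)))

[]=-consecutive⁺ : ∀ {T l q} → q < l → consecutive T l [ q ]= suc (T + q)
[]=-consecutive⁺ {T} {suc l} {zero} _ = subst (λ x → consecutive T (suc l) [ 0 ]= suc x) (sym (+-identityʳ T)) here
[]=-consecutive⁺ {T} {suc l} {suc q} (s≤s q<l) =
  subst (λ x → consecutive T (suc l) [ suc q ]= suc x) (sym (+-suc T q)) (there ([]=-consecutive⁺ q<l))

index<consecutive : ∀ {T l q e} → consecutive T l [ q ]= e → suc q ≤ e
index<consecutive {T} {q = q} p with []=-consecutive⁻ p
... | _ , refl = s≤s (m≤n+m q T)

consecutive-increasing : ∀ T l → Linked _<_ (consecutive T l)
consecutive-increasing T zero          = []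
consecutive-increasing T (suc zero)    = [-]
consecutive-increasing T (suc (suc l)) = n<1+n (suc T) ∷ consecutive-increasing (suc T) (suc l)

superstandardRest : ℤ → List (ℤ × Col) → List (ℤ × Col)
superstandardRest t []             = []
superstandardRest t ((p , c) ∷ rs) =
  (p , consecutive ℤ.∣ t ℤ.+ p ℤ.- len c ∣ (length c)) ∷ superstandardRest (t ℤ.+ p ℤ.- len c) rs

-- v with each box in row r holding r + 1; meaningful when all top rows are natural numbers.
superstandard : SCol → SCol
superstandard v = mkSCol (consecutive 0 (length (first v))) (superstandardRest (+ 0) (rest v))

tops-superstandard : ∀ v → tops (superstandard v) ≡ tops v
tops-superstandard v = cong (+ 0 ∷_) (go (+ 0) (rest v))
  where
  go : ∀ t rs → topsFrom t (superstandardRest t rs) ≡ topsFrom t rs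
  go t []             = refl
  go t ((p , c) ∷ rs) rewrite length-consecutive ℤ.∣ t ℤ.+ p ℤ.- len c ∣ (length c) = cong (_ ∷_) (go _ rs)

fillColumns : List ℤ → List Col → List Col
fillColumns (t ∷ ts) (c ∷ cs) = consecutive ℤ.∣ t ∣ (length c) ∷ fillColumns ts cs
fillColumns _        _        = []

columns-superstandard : ∀ v → columns (superstandard v) ≡ fillColumns (tops v) (columns v)
columns-superstandard v = cong (consecutive 0 (length (first v)) ∷_) (go (+ 0) (rest v))
  where
  go : ∀ t rs → map proj₂ (superstandardRest t rs) ≡ fillColumns (topsFrom t rs) (map proj₂ rs)
  go t []             = refl
  go t ((p , c) ∷ rs) = cong (_ ∷_) (go _ rs)

[]=-fillColumns⁻ : ∀ {ts cs j c′} → fillColumns ts cs [ j ]= c′ →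
  ∃₂ λ t c → ts [ j ]= t × cs [ j ]= c × c′ ≡ consecutive ℤ.∣ t ∣ (length c)
[]=-fillColumns⁻ {t ∷ ts} {c ∷ cs} here = t , c , here , here , refl
[]=-fillColumns⁻ {t ∷ ts} {c ∷ cs} (there p) with []=-fillColumns⁻ p
... | t′ , c′ , ts[j] , cs[j] , c≡ = t′ , c′ , there ts[j] , there cs[j] , c≡

[]=-fillColumns⁺ : ∀ {ts cs j t c} → ts [ j ]= t → cs [ j ]= c → fillColumns ts cs [ j ]= consecutive ℤ.∣ t ∣ (length c)
[]=-fillColumns⁺ here      here      = here
[]=-fillColumns⁺ (there p) (there q) = there ([]=-fillColumns⁺ p q)

[]=-superstandard⁻ : ∀ {v j c′} → columns (superstandard v) [ j ]= c′ →
  ∃₂ λ t c → tops v [ j ]= t × columns v [ j ]= c × c′ ≡ consecutive ℤ.∣ t ∣ (length c)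
[]=-superstandard⁻ {v} {j} {c′} p = []=-fillColumns⁻ (subst (_[ j ]= c′) (columns-superstandard v) p)

superstandard-modifyCol : ∀ j (h : ℕ → ℕ) v → superstandard (modifyCol j (map h) v) ≡ superstandard v
superstandard-modifyCol zero    h (mkSCol c rs) rewrite length-map h c = refl
superstandard-modifyCol (suc j) h (mkSCol c rs) = cong (mkSCol _) (go j (+ 0) rs)
  where
  go : ∀ j t rs → superstandardRest t (modifyRest j (map h) rs) ≡ superstandardRest t rs
  go j       t []              = refl
  go zero    t ((p , c) ∷ rs) rewrite length-map h c = refl
  go (suc j) t ((p , c) ∷ rs) = cong (_ ∷_) (go j _ rs)

≡consecutive : ∀ {T} {c : Col} → (∀ {q e} → c [ q ]= e → e ≡ suc (T + q)) → c ≡ consecutive T (length c)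
≡consecutive {T} {[]}    _      = refl
≡consecutive {T} {a ∷ c} placed =
  cong₂ _∷_ (trans (placed here) (cong suc (+-identityʳ T)))
            (≡consecutive λ c[q] → trans (placed (there c[q])) (cong suc (+-suc T _)))

≡superstandard : ∀ v → (∀ {j c t} → columns v [ j ]= c → tops v [ j ]= t → c ≡ consecutive ℤ.∣ t ∣ (length c)) →
  v ≡ superstandard v
≡superstandard (mkSCol c rs) filled = cong₂ mkSCol (filled here here) (go (+ 0) rs λ p q → filled (there p) (there q))
  where
  go : ∀ t rs → (∀ {k c t′} → map proj₂ rs [ k ]= c → topsFrom t rs [ k ]= t′ → c ≡ consecutive ℤ.∣ t′ ∣ (length c)) →
       rs ≡ superstandardRest t rs
  go t []             _      = refl
  go t ((p , c) ∷ rs) filled = cong₂ _∷_ (cong (p ,_) (filled here here)) (go _ rs λ p q → filled (there p) (there q))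

module Superstandard {n v} (v∈ : InScol n v) (rb : RowBounded v) where
  open RowBounded rb

  private
    topAt : ∀ {j t} → tops v [ j ]= t → ∃ λ T → topRows [ j ]= T × t ≡ + T
    topAt {j} {t} p = []=-map⁻ +_ (subst (_[ j ]= t) tops≡ p)

  ∈-superstandard⁻ : ∀ {r j e} → (r , j , e) ∈ boxes (superstandard v) →
    (∃ λ e′ → (r , j , e′) ∈ boxes v) × e ≡ suc ℤ.∣ r ∣
  ∈-superstandard⁻ {r} {j} {e} b∈ with ∈-boxes⁻ {superstandard v} b∈
  ... | c′ , t , q , w[j] , tops[j] , c′[q] , r≡ with []=-superstandard⁻ {v} w[j]
  ...   | t₁ , c , tops[j]′ , v[j] , refl
          with []=-functional tops[j]′ (subst (_[ j ]= t) (tops-superstandard v) tops[j]) | topAt tops[j]′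
  ...     | refl | T , _ , refl with []=-consecutive⁻ c′[q]
  ...       | q<len , refl with <length⇒[]= {xs = c} q<len
  ...         | e′ , c[q] rewrite r≡ = (e′ , ∈-boxes⁺ {v} v[j] tops[j]′ c[q]) , refl

  ∈-superstandard⁺ : ∀ {r j e} → (r , j , e) ∈ boxes v → (r , j , suc ℤ.∣ r ∣) ∈ boxes (superstandard v)
  ∈-superstandard⁺ {r} {j} b∈ with ∈-boxes⁻ {v} b∈
  ... | c , t , q , v[j] , tops[j] , c[q] , r≡ with topAt tops[j]
  ...   | T , _ , refl rewrite r≡ =
    ∈-boxes⁺ {superstandard v}
      (subst (_[ j ]= consecutive T (length c)) (sym (columns-superstandard v)) ([]=-fillColumns⁺ tops[j] v[j]))
      (subst (_[ j ]= + T) (sym (tops-superstandard v)) tops[j])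
      ([]=-consecutive⁺ ([]=⇒<length c[q]))

  private
    valid : All (ValidCol n) (columns (superstandard v))
    valid = All-[]= column-valid
      where
      column-valid : ∀ {j c′} → columns (superstandard v) [ j ]= c′ → ValidCol n c′
      column-valid p with []=-superstandard⁻ {v} p
      ... | t , c , tops[j] , v[j] , refl with topAt tops[j]
      ...   | T , Ts[j] , refl = nonEmpty c (proj₁ (validCol v∈ v[j])) , consecutive-increasing T (length c) , All-[]= bounded
        where
        nonEmpty : ∀ (c : Col) → ¬ c ≡ [] → ¬ consecutive T (length c) ≡ []
        nonEmpty []      c≢[] = ⊥-elim (c≢[] refl)
        nonEmpty (_ ∷ _) _    ()
        bounded : ∀ {q x} → consecutive T (length c) [ q ]= x → 1 ≤ x × x ≤ n
        bounded p with []=-consecutive⁻ p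
        ... | q<len , refl with <length⇒[]= {xs = c} q<len
        ...   | e , c[q] = s≤s z≤n , ≤-trans (row<entry (∈-boxes-natural⁺ tops≡ v[j] Ts[j] c[q]))
                                              (proj₂ (column-bounds (validCol v∈ v[j]) c[q]))

    rowConnected : RowConnected (superstandard v)
    rowConnected b₁ b₂ j<k k<j′ with ∈-superstandard⁻ b₁ | ∈-superstandard⁻ b₂
    ... | (_ , b₁∈v) , _ | (_ , b₂∈v) , _ with proj₁ (proj₂ v∈) b₁∈v b₂∈v j<k k<j′
    ...   | _ , b∈v = _ , ∈-superstandard⁺ b∈v

    rowIncreasing : RowIncreasing (superstandard v)
    rowIncreasing b₁ b₂ _ with ∈-superstandard⁻ b₁ | ∈-superstandard⁻ b₂
    ... | _ , refl | _ , refl = ≤-refl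

  superstandard∈ : InScol n (superstandard v)
  superstandard∈ = valid , rowConnected , rowIncreasing

  allPlaced⇒≡superstandard : AllPlaced v → v ≡ superstandard v
  allPlaced⇒≡superstandard placed = ≡superstandard v λ v[j] tops[j] → filled v[j] tops[j]
    where
    filled : ∀ {j c t} → columns v [ j ]= c → tops v [ j ]= t → c ≡ consecutive ℤ.∣ t ∣ (length c)
    filled v[j] tops[j] with topAt tops[j]
    ... | T , Ts[j] , refl = ≡consecutive λ c[q] → placed (∈-boxes-natural⁺ tops≡ v[j] Ts[j] c[q])

superstandard-cong : ∀ v w → lengths v ≡ lengths w → gluing v ≡ gluing w → superstandard v ≡ superstandard w
superstandard-cong (mkSCol c rs) (mkSCol c′ rs′) lengths≡ gluing≡ =
  cong₂ mkSCol (cong (consecutive 0) (∷-injectiveˡ lengths≡)) (go (+ 0) rs rs′ (∷-injectiveʳ lengths≡) gluing≡)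
  where
  go : ∀ t rs rs′ → map length (map proj₂ rs) ≡ map length (map proj₂ rs′) → map proj₁ rs ≡ map proj₁ rs′ →
       superstandardRest t rs ≡ superstandardRest t rs′
  go t []             []               _        _ = refl
  go t ((p , c) ∷ rs) ((p′ , c′) ∷ rs′) lengths≡ gluing≡ with ∷-injectiveˡ lengths≡ | ∷-injectiveˡ gluing≡
  ... | length≡ | refl rewrite length≡ = cong (_ ∷_) (go _ rs rs′ (∷-injectiveʳ lengths≡) (∷-injectiveʳ gluing≡))

rowsFrom : ℕ → ℕ → List ℕ
rowsFrom T zero    = []
rowsFrom T (suc l) = T ∷ rowsFrom (suc T) l

countℕ : ℕ → List ℕ → ℕ
countℕ k xs = length (filter (_≟ k) xs)

countℕ-++ : ∀ k xs ys → countℕ k (xs ++ ys) ≡ countℕ k xs + countℕ k ys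
countℕ-++ k xs ys = trans (cong length (filter-++ (_≟ k) xs ys)) (length-++ (filter (_≟ k) xs))

countℕ-here : ∀ k ys → countℕ k (k ∷ ys) ≡ suc (countℕ k ys)
countℕ-here k ys rewrite ≡ᵇ-refl k = refl

countℕ-there : ∀ k y ys → ¬ y ≡ k → countℕ k (y ∷ ys) ≡ countℕ k ys
countℕ-there k y ys y≢k rewrite ≢⇒≡ᵇ-false y k y≢k = refl

countℕ-absent : ∀ k ys → All (_< k) ys → countℕ k ys ≡ 0
countℕ-absent k []       []          = refl
countℕ-absent k (y ∷ ys) (y<k ∷ ys<k) = trans (countℕ-there k y ys (<⇒≢ y<k)) (countℕ-absent k ys ys<k)

meets : ℕ → ℕ → ℕ → ℕ
meets T l k = countℕ k (rowsFrom T l)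

meets-above : ∀ T l k → k < T → meets T l k ≡ 0
meets-above T zero    k _   = refl
meets-above T (suc l) k k<T = trans (countℕ-there k T _ (>⇒≢ k<T)) (meets-above (suc T) l k (m<n⇒m<1+n k<T))

meets-below : ∀ T l k → T + l ≤ k → meets T l k ≡ 0
meets-below T zero    k _        = refl
meets-below T (suc l) k T+l+1≤k =
  trans (countℕ-there k T _ (<⇒≢ (<-≤-trans (m<m+n T (s≤s z≤n)) T+l+1≤k)))
        (meets-below (suc T) l k (subst (_≤ k) (+-suc T l) T+l+1≤k))

meets-inside : ∀ T l k → T ≤ k → k < T + l → meets T l k ≡ 1
meets-inside T zero    k T≤k k<T+0 = ⊥-elim (<-irrefl refl (<-≤-trans k<T+0 (subst (_≤ k) (sym (+-identityʳ T)) T≤k)))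
meets-inside T (suc l) k T≤k k<T+l with T ≟ k
... | yes refl = trans (countℕ-here T _) (cong suc (meets-above (suc T) l T (n<1+n T)))
... | no T≢k   = trans (countℕ-there k T _ T≢k)
                       (meets-inside (suc T) l k (≤∧≢⇒< T≤k T≢k) (subst (k <_) (+-suc T l) k<T+l))

rowCount : List ℕ → List ℕ → ℕ → ℕ
rowCount (T ∷ Ts) (l ∷ ls) k = meets T l k + rowCount Ts ls k
rowCount _        _        k = 0

rowsOf : List ℕ → List Col → List ℕ
rowsOf (T ∷ Ts) (c ∷ cs) = rowsFrom T (length c) ++ rowsOf Ts cs
rowsOf _        _        = []

rows-boxesFrom : ∀ j Ts cs → map proj₁ (boxesFrom j (map +_ Ts) cs) ≡ map +_ (rowsOf Ts cs)
rows-boxesFrom j []       cs       = refl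
rows-boxesFrom j (T ∷ Ts) []       = refl
rows-boxesFrom j (T ∷ Ts) (c ∷ cs) =
  trans (map-++ proj₁ (colBoxes (+ T) j c) _)
        (trans (cong₂ _++_ (rows-colBoxes T c) (rows-boxesFrom (suc j) Ts cs))
               (sym (map-++ +_ (rowsFrom T (length c)) _)))
  where
  rows-colBoxes : ∀ T c → map proj₁ (colBoxes (+ T) j c) ≡ map +_ (rowsFrom T (length c))
  rows-colBoxes T []      = refl
  rows-colBoxes T (x ∷ c) =
    cong (+ T ∷_) (trans (cong (λ t → map proj₁ (colBoxes (+ t) j c)) (+-comm T 1)) (rows-colBoxes (suc T) c))

countℕ-rowsOf : ∀ k Ts cs → countℕ k (rowsOf Ts cs) ≡ rowCount Ts (map length cs) k
countℕ-rowsOf k []       cs       = refl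
countℕ-rowsOf k (T ∷ Ts) []       = refl
countℕ-rowsOf k (T ∷ Ts) (c ∷ cs) =
  trans (countℕ-++ k (rowsFrom T (length c)) _) (cong (_+_ (meets T (length c) k)) (countℕ-rowsOf k Ts cs))

private
  maximum : List ℕ → ℕ
  maximum = foldr _⊔_ 0

  ≤-maximum : ∀ ns → All (_≤ maximum ns) ns
  ≤-maximum []       = []
  ≤-maximum (x ∷ ns) = m≤m⊔n x (maximum ns) ∷ All.map (λ y≤ → ≤-trans y≤ (m≤n⊔m x (maximum ns))) (≤-maximum ns)

  count-+ : ∀ k ns → count (+ k) (map +_ ns) ≡ countℕ k ns
  count-+ k []       = refl
  count-+ k (y ∷ ns) with does (y ≟ k)
  ... | true  = cong suc (count-+ k ns)
  ... | false = count-+ k ns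

  minimum≡0 : ∀ ns → foldr ℤ._⊓_ (+ 0) (map +_ ns) ≡ + 0
  minimum≡0 []       = refl
  minimum≡0 (x ∷ ns) rewrite minimum≡0 ns = cong +_ (⊓-zeroʳ x)

  maximum≡ : ∀ ns → foldr ℤ._⊔_ (+ 0) (map +_ ns) ≡ + maximum ns
  maximum≡ []       = refl
  maximum≡ (x ∷ ns) rewrite maximum≡ ns = refl

  shapeOfRows-ℕ : ∀ ns → shapeOfRows (map +_ (0 ∷ ns)) ≡ map (λ k → countℕ k (0 ∷ ns)) (upTo (suc (maximum ns)))
  shapeOfRows-ℕ ns rewrite minimum≡0 ns | maximum≡ ns | +-identityʳ (maximum ns) =
    map-cong (λ k → count-+ k (0 ∷ ns)) (upTo (suc (maximum ns)))

  []=-upTo : ∀ (f : ℕ → ℕ) R k → k < R → applyUpTo f R [ k ]= f k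
  []=-upTo f (suc R) zero    _       = here
  []=-upTo f (suc R) (suc k) (s≤s k<R) = there ([]=-upTo (f ∘ suc) R k k<R)

  length-counts : ∀ ms → length (map (λ k → countℕ k (0 ∷ ms)) (upTo (suc (maximum ms)))) ≡ suc (maximum ms)
  length-counts ms = trans (length-map (λ k → countℕ k (0 ∷ ms)) (upTo (suc (maximum ms)))) (length-applyUpTo (λ x → x) (suc (maximum ms)))

  countℕ-beyond : ∀ ms {k} → suc (maximum ms) ≤ k → countℕ k (0 ∷ ms) ≡ 0
  countℕ-beyond ms {k} max<k = countℕ-absent k _ (All.map (λ x≤ → <-≤-trans (s≤s x≤) max<k) (z≤n ∷ ≤-maximum ms))

shapeOfRows-countℕ : ∀ ns ns′ → shapeOfRows (map +_ (0 ∷ ns)) ≡ shapeOfRows (map +_ (0 ∷ ns′)) →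
  ∀ k → countℕ k (0 ∷ ns) ≡ countℕ k (0 ∷ ns′)
shapeOfRows-countℕ ns ns′ eq k with trans (sym (shapeOfRows-ℕ ns)) (trans eq (shapeOfRows-ℕ ns′))
... | counts≡ with trans (sym (length-counts ns)) (trans (cong length counts≡) (length-counts ns′)) | k <? suc (maximum ns)
...   | R≡R′ | yes k<R = []=-functional ([]=-map⁺ (λ k → countℕ k (0 ∷ ns)) ([]=-upTo (λ x → x) _ k k<R))
                           (subst (_[ k ]= countℕ k (0 ∷ ns′)) (sym counts≡)
                             ([]=-map⁺ (λ k → countℕ k (0 ∷ ns′)) ([]=-upTo (λ x → x) _ k (subst (k <_) R≡R′ k<R))))
...   | R≡R′ | no k≮R  = trans (countℕ-beyond ns (≮⇒≥ k≮R)) (sym (countℕ-beyond ns′ (subst (_≤ k) R≡R′ (≮⇒≥ k≮R))))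

private
  rows≡0∷ : ∀ v {Ts} → tops v ≡ map +_ (0 ∷ Ts) → ¬ first v ≡ [] →
    ∃ λ ns → map proj₁ (boxes v) ≡ map +_ (0 ∷ ns)
           × (∀ k → countℕ k (0 ∷ ns) ≡ rowCount (0 ∷ Ts) (map length (columns v)) k)
  rows≡0∷ (mkSCol []      rs) _ c≢[] = ⊥-elim (c≢[] refl)
  rows≡0∷ v@(mkSCol (_ ∷ c) rs) {Ts} tops≡ _ =
    rowsFrom 1 (length c) ++ rowsOf Ts (map proj₂ rs) ,
    trans (cong (λ ts → map proj₁ (boxesFrom 0 ts (columns v))) tops≡) (rows-boxesFrom 0 (0 ∷ Ts) (columns v)) ,
    λ k → countℕ-rowsOf k (0 ∷ Ts) (columns v)

shape≡⇒rowCount≡ : ∀ v w {Ts Ts′} → tops v ≡ map +_ (0 ∷ Ts) → ¬ first v ≡ [] →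
  tops w ≡ map +_ (0 ∷ Ts′) → ¬ first w ≡ [] → shape v ≡ shape w →
  ∀ k → rowCount (0 ∷ Ts) (map length (columns v)) k ≡ rowCount (0 ∷ Ts′) (map length (columns w)) k
shape≡⇒rowCount≡ v w tops≡ v≢[] tops≡′ w≢[] shape≡ k with rows≡0∷ v tops≡ v≢[] | rows≡0∷ w tops≡′ w≢[]
... | ns , rows≡ , counts≡ | ns′ , rows≡′ , counts≡′ =
  trans (sym (counts≡ k)) (trans (shapeOfRows-countℕ ns ns′ shapes≡ k) (counts≡′ k))
  where
  shapes≡ : shapeOfRows (map +_ (0 ∷ ns)) ≡ shapeOfRows (map +_ (0 ∷ ns′))
  shapes≡ = begin
    shapeOfRows (map +_ (0 ∷ ns))     ≡⟨ cong shapeOfRows rows≡ ⟨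
    shapeOfRows (map proj₁ (boxes v)) ≡⟨ shape≡shapeOfRows v ⟨
    shape v                           ≡⟨ shape≡ ⟩
    shape w                           ≡⟨ shape≡shapeOfRows w ⟩
    shapeOfRows (map proj₁ (boxes w)) ≡⟨ cong shapeOfRows rows≡′ ⟩
    shapeOfRows (map +_ (0 ∷ ns′))    ∎
    where open ≡-Reasoning

-- Connected components

-- What the argument needs to know about Young, respectively quasi-ribbon, tableaux.
record TableauClass (n : ℕ) : Set₁ where
  field
    Glued                 : SCol → Set
    rowBounded            : ∀ {v} → InScol n v → Glued v → RowBounded v
    signsAround           : ∀ {v} (v∈ : InScol n v) (g : Glued v) (m : LeastMisplaced v (RowBounded.topRows (rowBounded v∈ g))) →
                            SignsAround (LeastMisplaced.i m) (columns v) (LeastMisplaced.col m)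
    glued-cong            : ∀ {v w} → lengths v ≡ lengths w → gluing v ≡ gluing w → Glued v → Glued w
    superstandard-highest : ∀ {v} → InScol n v → Glued v → HighestWeight n (superstandard v)
    shape⇒superstandard≡  : ∀ {v w} → InScol n v → Glued v → InScol n w → Glued w →
                            shape v ≡ shape w → superstandard v ≡ superstandard w

module Component {n} (K : TableauClass n) where
  open TableauClass K

  Member : SCol → Set
  Member v = InScol n v × Glued v

  module LowerMisplaced {v} (v∈ : InScol n v) (g : Glued v) (m : LeastMisplaced v (RowBounded.topRows (rowBounded v∈ g))) where
    open LeastMisplaced m public using (i; col; 1≤i)
    open AtLeastMisplaced v∈ (rowBounded v∈ g) m public using (i<n)
    open AtLeastMisplaced v∈ (rowBounded v∈ g) m using (loweringSite)
    open Lowering v∈ 1≤i i<n (loweringSite (signsAround v∈ g m)) public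

  record Invariants (w v : SCol) : Set where
    constructor invariants
    field
      member         : Member v
      superstandard≡ : superstandard v ≡ superstandard w
      shape≡         : shape v ≡ shape w

  private
    glued-modifyCol : ∀ j h v → Glued v → Glued (modifyCol j (map h) v)
    glued-modifyCol j h v = glued-cong (sym (lengths-modifyCol j h v)) (sym (gluing-modifyCol j (map h) v))

    glued-modifyCol⁻ : ∀ j h v → Glued (modifyCol j (map h) v) → Glued v
    glued-modifyCol⁻ j h v = glued-cong (lengths-modifyCol j h v) (gluing-modifyCol j (map h) v)

    arrow-invariant : ∀ {v d} → Arrow n v d → Glued v → Invariants v d
    arrow-invariant {v} {d} (_ , i , _ , fc , d∈) g with fCand⇒modifyCol i v d fc
    ... | j , refl = invariants (d∈ , glued-modifyCol j _ v g) (superstandard-modifyCol j _ v) (shape-modifyCol j _ v)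

    arrow-invariant⁻ : ∀ {v d} → Arrow n d v → Glued v → Invariants v d
    arrow-invariant⁻ {v} {d} (d∈ , i , _ , fc , _) g with fCand⇒modifyCol i d v fc
    ... | j , refl = invariants (d∈ , glued-modifyCol⁻ j _ d g) (sym (superstandard-modifyCol j _ d)) (sym (shape-modifyCol j _ d))

    Invariants-trans : ∀ {w u v} → Invariants w u → Invariants u v → Invariants w v
    Invariants-trans (invariants _ ss≡ shape≡) (invariants v∈ ss≡′ shape≡′) = invariants v∈ (trans ss≡′ ss≡) (trans shape≡′ shape≡)

  connected-invariant : ∀ {w v} → Member w → Connected n w v → Invariants w v
  connected-invariant w∈ ε = invariants w∈ refl refl
  connected-invariant w∈ (fwd a ◅ steps) with arrow-invariant a (proj₂ w∈)
  ... | u-inv = Invariants-trans u-inv (connected-invariant (Invariants.member u-inv) steps)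
  connected-invariant w∈ (bwd a ◅ steps) with arrow-invariant⁻ a (proj₂ w∈)
  ... | u-inv = Invariants-trans u-inv (connected-invariant (Invariants.member u-inv) steps)

  -- By induction on the sum of the entries: lowering the least misplaced entry is undone by an f-arrow.
  superstandard-connected : ∀ v → Member v → Connected n (superstandard v) v
  superstandard-connected = WF.All.wfRec (On.wellFounded entrySum <-wellFounded) _ _ step
    where
    step : ∀ v → (∀ {u} → entrySum u < entrySum v → Member u → Connected n (superstandard u) u) →
           Member v → Connected n (superstandard v) v
    step v smaller (v∈ , g) with allPlaced⊎leastMisplaced v (rowBounded v∈ g)
    ... | inj₁ placed =
      subst (λ u → Connected n u v) (Superstandard.allPlaced⇒≡superstandard v∈ (rowBounded v∈ g) placed) ε
    ... | inj₂ m =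
      subst (λ u → Connected n u v) (superstandard-modifyCol col _ v)
        (smaller entrySum-lowered (lowered∈ , glued-modifyCol col _ v g)
          ◅◅ fwd (lowered∈ , i , (1≤i , i<n) , fStep) ◅ ε)
      where open LowerMisplaced v∈ g m

  highest-unique : ∀ {w} → Member w → ∀ h → Connected n w h → HighestWeight n h → h ≡ superstandard w
  highest-unique w∈ h w~h (h∈ , no-e) with connected-invariant w∈ w~h
  ... | invariants (_ , g) ss≡ _ with allPlaced⊎leastMisplaced h (rowBounded h∈ g)
  ...   | inj₁ placed = trans (Superstandard.allPlaced⇒≡superstandard h∈ (rowBounded h∈ g) placed) ss≡
  ...   | inj₂ m      = ⊥-elim (no-e i (1≤i , i<n) _ eStep)
    where open LowerMisplaced h∈ g m

  isComponentWithUniqueHW : ∀ w → Member w → IsComponentWithUniqueHW n Member w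
  isComponentWithUniqueHW w w∈ =
    (λ v → mk⇔ (sameShape⇒connected v) (connected⇒sameShape v)) ,
    superstandard w , w~superstandard , superstandard-highest (proj₁ w∈) (proj₂ w∈) , highest-unique w∈
    where
    w~superstandard : Connected n w (superstandard w)
    w~superstandard = symmetric (Arrow n) (superstandard-connected w w∈)

    sameShape⇒connected : ∀ v → Member v × shape v ≡ shape w → Connected n w v
    sameShape⇒connected v ((v∈ , gv) , shape≡) =
      w~superstandard ◅◅ subst (λ u → Connected n u v)
                               (shape⇒superstandard≡ v∈ gv (proj₁ w∈) (proj₂ w∈) shape≡)
                               (superstandard-connected v (v∈ , gv))

    connected⇒sameShape : ∀ v → Connected n w v → Member v × shape v ≡ shape w
    connected⇒sameShape v w~v = Invariants.member inv , Invariants.shape≡ inv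
      where inv = connected-invariant w∈ w~v

-- Young tableaux

Aligned : List (ℤ × Col) → Set
Aligned = All (λ pc → proj₁ pc ≡ len (proj₂ pc))

YoungGlued : SCol → Set
YoungGlued v = Aligned (rest v) × Linked _≥_ (lengths v)

private
  t+p-p≡t : ∀ t p → t ℤ.+ p ℤ.- p ≡ t
  t+p-p≡t = solve-∀

  zeros : SCol → List ℕ
  zeros v = map (λ _ → 0) (columns v)

young-tops : ∀ v → Aligned (rest v) → tops v ≡ map +_ (zeros v)
young-tops (mkSCol c rs) aligned = cong (+ 0 ∷_) (go rs aligned)
  where
  go : ∀ rs → Aligned rs → topsFrom (+ 0) rs ≡ map +_ (map (λ _ → 0) (map proj₂ rs))
  go []             []               = refl
  go ((p , c) ∷ rs) (refl ∷ aligned) rewrite t+p-p≡t (+ 0) (len c) = cong (+ 0 ∷_) (go rs aligned)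

youngRowBounded : ∀ {n v} → InScol n v → YoungGlued v → RowBounded v
youngRowBounded {v = v} v∈ (aligned , _) = record { topRows = zeros v ; tops≡ = young-tops v aligned ; row<entry = bound }
  where
  bound : ∀ {r j e} → (+ r , j , e) ∈ boxes v → suc r ≤ e
  bound b∈ with ∈-boxes-natural⁻ (young-tops v aligned) b∈
  ... | c , T , q , v[j] , Ts[j] , c[q] , refl with []=-map⁻ (λ _ → 0) {columns v} Ts[j]
  ...   | _ , _ , refl = index<entry (validCol v∈ v[j]) c[q]

module _ {n v} (v∈ : InScol n v) (g : YoungGlued v) where
  private
    rb = youngRowBounded v∈ g
    open RowBounded rb

    top0 : ∀ {j c} → columns v [ j ]= c → zeros v [ j ]= 0
    top0 = []=-map⁺ (λ _ → 0)

  -- Left of the chosen column an entry i + 1 is placed, so i sits above it; right of it an entry i is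
  -- placed, and the entry in the chosen row would lie between i + 1 (row increasing) and i (column increasing).
  young-signsAround : (m : LeastMisplaced v topRows) → SignsAround (LeastMisplaced.i m) (columns v) (LeastMisplaced.col m)
  young-signsAround m = left , right
    where
    open LeastMisplaced m

    left : ∀ {j c} → j < col → columns v [ j ]= c → PlusOrNone i c
    left {j} {c} j<col v[j] = plusOrNone i c λ i+1∈ → i∈ (mem⇒[]= (suc i) c i+1∈)
      where
      vc = validCol v∈ v[j]
      i∈ : ∃ (λ q → c [ q ]= suc i) → mem i c ≡ true
      i∈ (q , c[q]) with suc q <? suc i
      ... | yes q+1<i+1 = ⊥-elim (<-irrefl refl (<-≤-trans j<col (leftmost (∈-boxes-natural⁺ tops≡ v[j] (top0 v[j]) c[q]) q+1<i+1)))
      ... | no  q+1≮i+1 = pred-entry∈ (proj₁ (proj₂ vc)) (index<entry vc) (subst (λ x → c [ x ]= suc i) q≡i c[q]) 1≤i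
        where
        q≡i : q ≡ i
        q≡i = suc-injective (≤-antisym (index<entry vc c[q]) (≮⇒≥ q+1≮i+1))

    right : ∀ {j c} → col < j → columns v [ j ]= c → MinusOrNone i c
    right {j} {c} col<j v[j] = minusOrNone i c λ i∈ → ⊥-elim (i∉ (mem⇒[]= i c i∈))
      where
      i∉ : ∃ (λ q → c [ q ]= i) → ⊥
      i∉ (q , c[q]) = <-irrefl refl (<-≤-trans (n<1+n i) (≤-trans i+1≤y y≤i))
        where
        i≡ : i ≡ suc q
        i≡ = placed-below rb m (∈-boxes-natural⁺ tops≡ v[j] (top0 v[j]) c[q]) (n<1+n i)
        row≤q : row ≤ q
        row≤q = ≤-pred (subst (row <_) i≡ (≤-pred misplaced))
        y = proj₁ ([]=-downward c[q] row≤q)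
        c[row] = proj₂ ([]=-downward c[q] row≤q)
        i+1≤y : suc i ≤ y
        i+1≤y = proj₂ (proj₂ v∈) box (∈-boxes-natural⁺ tops≡ v[j] (top0 v[j]) c[row]) col<j
        y≤i : y ≤ i
        y≤i = column-≤ (proj₁ (proj₂ (validCol v∈ v[j]))) c[row] c[q] row≤q

  young-superstandard-highest : HighestWeight n (superstandard v)
  young-superstandard-highest = superstandard∈ , λ i (1≤i , _) d (ec , _) → no-eCand i 1≤i d ec
    where
    open Superstandard v∈ rb using (superstandard∈)
    -- Every column of the superstandard Young tableau is 1, 2, …, l, so i + 1 in it comes with i.
    no-eCand : ∀ i → 1 ≤ i → ∀ d → ¬ eCand i (superstandard v) ≡ just d
    no-eCand i 1≤i d ec with eCand⇒modifyCol i (superstandard v) d ec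
    ... | j , c′ , _ , ss[j] , i∉ , i+1∈ with []=-superstandard⁻ {v} ss[j]
    ...   | t , c , tops[j] , v[j] , refl
            with []=-functional tops[j] (subst (_[ j ]= + 0) (sym tops≡) ([]=-map⁺ +_ (top0 v[j])))
    ...     | refl with mem⇒[]= (suc i) (consecutive 0 (length c)) i+1∈
    ...       | q , c′[q] with []=-consecutive⁻ c′[q]
    ...         | _ , refl with trans (sym (pred-entry∈ (consecutive-increasing 0 (length c)) index<consecutive c′[q] 1≤i)) i∉
    ...           | ()

aligned⇒gluing : ∀ rs → Aligned rs → map proj₁ rs ≡ map +_ (map length (map proj₂ rs))
aligned⇒gluing []             []               = refl
aligned⇒gluing ((p , c) ∷ rs) (p≡ ∷ aligned) = cong₂ _∷_ p≡ (aligned⇒gluing rs aligned)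

gluing⇒aligned : ∀ rs → map proj₁ rs ≡ map +_ (map length (map proj₂ rs)) → Aligned rs
gluing⇒aligned []             _  = []
gluing⇒aligned ((p , c) ∷ rs) eq = ∷-injectiveˡ eq ∷ gluing⇒aligned rs (∷-injectiveʳ eq)

young-glued-cong : ∀ {v w} → lengths v ≡ lengths w → gluing v ≡ gluing w → YoungGlued v → YoungGlued w
young-glued-cong {v} {w} lengths≡ gluing≡ (aligned , decreasing) =
  gluing⇒aligned (rest w) (begin
    gluing w                                   ≡⟨ gluing≡ ⟨
    gluing v                                   ≡⟨ aligned⇒gluing (rest v) aligned ⟩
    (map +_ (map length (map proj₂ (rest v)))) ≡⟨ cong (λ ls → map +_ ls) (∷-injectiveʳ lengths≡) ⟩
    (map +_ (map length (map proj₂ (rest w)))) ∎) ,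
  subst (Linked _≥_) lengths≡ decreasing
  where open ≡-Reasoning

youngRowCount : List ℕ → ℕ → ℕ
youngRowCount []      k = 0
youngRowCount (l ∷ L) k = meets 0 l k + youngRowCount L k

rowCount-zeros : ∀ (cs : List Col) k → rowCount (map (λ _ → 0) cs) (map length cs) k ≡ youngRowCount (map length cs) k
rowCount-zeros []       k = refl
rowCount-zeros (c ∷ cs) k = cong (_+_ (meets 0 (length c) k)) (rowCount-zeros cs k)

youngRowCount-beyond : ∀ L k → All (_≤ k) L → youngRowCount L k ≡ 0
youngRowCount-beyond []      k []           = refl
youngRowCount-beyond (l ∷ L) k (l≤k ∷ L≤k) rewrite meets-below 0 l k l≤k = youngRowCount-beyond L k L≤k

youngRowCount-within : ∀ l L k → k < l → 1 ≤ youngRowCount (l ∷ L) k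
youngRowCount-within l L k k<l rewrite meets-inside 0 l k z≤n k<l = s≤s z≤n

private
  ≤-head : ∀ {m M} → Linked _≥_ (m ∷ M) → All (_≤ m) M
  ≤-head {M = []}    _                  = []
  ≤-head {M = _ ∷ _} (m≥m′ ∷ decreasing) = Linked⇒All (flip ≤-trans) m≥m′ decreasing

  head-≤ : ∀ l L m M → Linked _≥_ (m ∷ M) → (∀ k → youngRowCount (l ∷ L) k ≡ youngRowCount (m ∷ M) k) → l ≤ m
  head-≤ l L m M decreasing counts≡ with l ≤? m
  ... | yes l≤m = l≤m
  ... | no  l≰m = ⊥-elim (<⇒≢ (youngRowCount-within l L m (≰⇒> l≰m))
                              (sym (trans (counts≡ m) (youngRowCount-beyond (m ∷ M) m (≤-refl ∷ ≤-head decreasing)))))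

-- Row k of a Young diagram has as many boxes as there are columns longer than k, so the row counts
-- determine the decreasing sequence of column lengths.
youngRowCount-injective : ∀ L M → All (1 ≤_) L → All (1 ≤_) M → Linked _≥_ L → Linked _≥_ M →
  (∀ k → youngRowCount L k ≡ youngRowCount M k) → L ≡ M
youngRowCount-injective []      []      _ _ _ _ _ = refl
youngRowCount-injective []      (m ∷ M) _ (1≤m ∷ _) _ _ counts≡ = ⊥-elim (<⇒≢ (youngRowCount-within m M 0 1≤m) (counts≡ 0))
youngRowCount-injective (l ∷ L) []      (1≤l ∷ _) _ _ _ counts≡ = ⊥-elim (<⇒≢ (youngRowCount-within l L 0 1≤l) (sym (counts≡ 0)))
youngRowCount-injective (l ∷ L) (m ∷ M) (_ ∷ L⁺) (_ ∷ M⁺) decL decM counts≡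
  with ≤-antisym (head-≤ l L m M decM counts≡) (head-≤ m M l L decL (sym ∘ counts≡))
... | refl = cong (l ∷_) (youngRowCount-injective L M L⁺ M⁺ (Linked.tail decL) (Linked.tail decM)
                            λ k → +-cancelˡ-≡ (meets 0 l k) _ _ (counts≡ k))

young-shape⇒superstandard≡ : ∀ {n v w} → InScol n v → YoungGlued v → InScol n w → YoungGlued w →
  shape v ≡ shape w → superstandard v ≡ superstandard w
young-shape⇒superstandard≡ {v = v} {w} v∈ (aligned-v , decreasing-v) w∈ (aligned-w , decreasing-w) shape≡ =
  superstandard-cong v w lengths≡ gluing≡
  where
  rowCounts≡ = shape≡⇒rowCount≡ v w (young-tops v aligned-v) (proj₁ (All.head (proj₁ v∈)))
                                    (young-tops w aligned-w) (proj₁ (All.head (proj₁ w∈))) shape≡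
  lengths≡ : lengths v ≡ lengths w
  lengths≡ = youngRowCount-injective (lengths v) (lengths w) (lengths-positive (proj₁ v∈)) (lengths-positive (proj₁ w∈)) decreasing-v decreasing-w
               λ k → trans (sym (rowCount-zeros (columns v) k)) (trans (rowCounts≡ k) (rowCount-zeros (columns w) k))
  gluing≡ : gluing v ≡ gluing w
  gluing≡ = trans (aligned⇒gluing (rest v) aligned-v)
                  (trans (cong (λ ls → map +_ ls) (∷-injectiveʳ lengths≡)) (sym (aligned⇒gluing (rest w) aligned-w)))

youngTableaux : ∀ n → TableauClass n
youngTableaux n = record
  { Glued                 = YoungGlued
  ; rowBounded            = youngRowBounded
  ; signsAround           = λ v∈ g → young-signsAround v∈ g
  ; glued-cong            = λ {v} {w} → young-glued-cong {v} {w}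
  ; superstandard-highest = young-superstandard-highest
  ; shape⇒superstandard≡  = young-shape⇒superstandard≡
  }

-- Quasi-ribbon tableaux

ribbonTops : ℕ → List Col → List ℕ
ribbonTops T []       = []
ribbonTops T (c ∷ cs) = T ∷ ribbonTops (T + pred (length c)) cs

private
  glued-top : ∀ t a b → t ℤ.+ (a ℤ.+ b ℤ.- + 1) ℤ.- b ≡ t ℤ.+ a ℤ.- + 1
  glued-top = solve-∀

  t+[1+a]-1≡t+a : ∀ t a → t ℤ.+ (+ 1 ℤ.+ a) ℤ.- + 1 ≡ t ℤ.+ a
  t+[1+a]-1≡t+a = solve-∀

-- The top box of each column is in the row of the bottom box of the previous one.
ribbon-tops : ∀ v → QRGlue (first v) (rest v) → All (λ c → ¬ c ≡ []) (columns v) → tops v ≡ map +_ (ribbonTops 0 (columns v))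
ribbon-tops (mkSCol c rs) glued (c≢[] ∷ cs≢[]) = cong (+ 0 ∷_) (go 0 c rs glued c≢[] cs≢[])
  where
  go : ∀ T c rs → QRGlue c rs → ¬ c ≡ [] → All (λ c → ¬ c ≡ []) (map proj₂ rs) →
       topsFrom (+ T) rs ≡ map +_ (ribbonTops (T + pred (length c)) (map proj₂ rs))
  go T c             []              _             _ _ = refl
  go T []            ((p , c′) ∷ rs) _             c≢[] _ = ⊥-elim (c≢[] refl)
  go T c@(_ ∷ c₀) ((p , c′) ∷ rs) (refl , glued) _    (c′≢[] ∷ cs≢[]) =
    cong₂ _∷_ top≡ (trans (cong (λ t → topsFrom t rs) top≡) (go (T + length c₀) c′ rs glued c′≢[] cs≢[]))
    where
    top≡ : + T ℤ.+ (len c ℤ.+ len c′ ℤ.- + 1) ℤ.- len c′ ≡ + (T + length c₀)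
    top≡ = trans (glued-top (+ T) (len c) (len c′)) (t+[1+a]-1≡t+a (+ T) (+ length c₀))

ribbonTops-[]= : ∀ {T cs j c} → cs [ j ]= c → ∃ λ t → ribbonTops T cs [ j ]= t
ribbonTops-[]= here      = _ , here
ribbonTops-[]= (there p) with ribbonTops-[]= p
... | t , q = t , there q

ribbonTops-suc : ∀ {T cs j c t t′} → cs [ j ]= c → ribbonTops T cs [ j ]= t → ribbonTops T cs [ suc j ]= t′ →
  t′ ≡ t + pred (length c)
ribbonTops-suc {cs = c ∷ c′ ∷ cs} here      here      (there here) = refl
ribbonTops-suc {cs = c ∷ cs}      (there p) (there q) (there r)    = ribbonTops-suc p q r

ribbonTops-zero : ∀ {T cs t} → ribbonTops T cs [ 0 ]= t → t ≡ T
ribbonTops-zero {cs = c ∷ cs} here = refl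

ribbonTops-mono : ∀ {T cs j j′ t t′} → j ≤ j′ → ribbonTops T cs [ j ]= t → ribbonTops T cs [ j′ ]= t′ → t ≤ t′
ribbonTops-mono {T} {c ∷ cs} z≤n here q = ≥T {cs = c ∷ cs} q
  where
  ≥T : ∀ {T cs j t} → ribbonTops T cs [ j ]= t → T ≤ t
  ≥T {T} {c ∷ cs} here      = ≤-refl
  ≥T {T} {c ∷ cs} (there q) = ≤-trans (m≤m+n T _) (≥T q)
ribbonTops-mono {T} {c ∷ cs} (s≤s j≤j′) (there p) (there q) = ribbonTops-mono j≤j′ p q

module RibbonGeometry {n v} (v∈ : InScol n v) (glued : QRGlue (first v) (rest v)) where

  Ts : List ℕ
  Ts = ribbonTops 0 (columns v)

  tops≡ : tops v ≡ map +_ Ts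
  tops≡ = ribbon-tops v glued (All.map proj₁ (proj₁ v∈))

  private
    nonEmpty : ∀ {j c} → columns v [ j ]= c → ¬ c ≡ []
    nonEmpty = proj₁ ∘ validCol v∈

    increasing : ∀ {j c} → columns v [ j ]= c → Linked _<_ c
    increasing = proj₁ ∘ proj₂ ∘ validCol v∈

    head+index≤′ : ∀ {c a q b} → Linked _<_ c → c [ 0 ]= a → c [ q ]= b → a + q ≤ b
    head+index≤′ increasing here c[q] = head+index≤ increasing c[q]

  record Adjacent (j : ℕ) (c c₁ : Col) (T : ℕ) : Set where
    field
      bottom top₁  : ℕ
      bottom-at    : c [ pred (length c) ]= bottom
      top₁-at      : c₁ [ 0 ]= top₁
      bottom≤top₁  : bottom ≤ top₁
      T₁           : ℕ
      T₁-at        : Ts [ suc j ]= T₁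
      T₁≡          : T₁ ≡ T + pred (length c)

  adjacent : ∀ {j c c₁ T} → columns v [ j ]= c → Ts [ j ]= T → columns v [ suc j ]= c₁ → Adjacent j c c₁ T
  adjacent {j} {c} {c₁} {T} v[j] Ts[j] v[j+1] with ribbonTops-[]= v[j+1] | []=-last (nonEmpty v[j]) | []=-head (nonEmpty v[j+1])
  ... | T₁ , Ts[j+1] | b , c[last] | a₁ , c₁[0] = record
    { bottom = b ; top₁ = a₁ ; bottom-at = c[last] ; top₁-at = c₁[0] ; T₁ = T₁ ; T₁-at = Ts[j+1] ; T₁≡ = T₁≡
    ; bottom≤top₁ = proj₂ (proj₂ v∈) (∈-boxes-natural⁺ tops≡ v[j] Ts[j] c[last])
                      (subst (λ r → (+ r , suc j , a₁) ∈ boxes v) (trans (+-identityʳ T₁) T₁≡) (∈-boxes-natural⁺ tops≡ v[j+1] Ts[j+1] c₁[0]))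
                      (n<1+n j) }
    where
    T₁≡ : T₁ ≡ T + pred (length c)
    T₁≡ = ribbonTops-suc v[j] Ts[j] Ts[j+1]

  top-entry : ∀ j {c T a} → columns v [ j ]= c → Ts [ j ]= T → c [ 0 ]= a → suc T ≤ a
  top-entry zero    v[0] Ts[0] c[0] rewrite ribbonTops-zero {0} {columns v} Ts[0] = proj₁ (column-bounds (validCol v∈ v[0]) c[0])
  top-entry (suc j) {c} {T} {a} v[j+1] Ts[j+1] c[0] with []=-downward v[j+1] (n≤1+n j)
  ... | c′ , v[j] with ribbonTops-[]= {0} v[j]
  ...   | T′ , Ts[j] with adjacent v[j] Ts[j] v[j+1] | []=-head (nonEmpty v[j])
  ...     | adj | a′ , c′[0] = subst (_≤ a) (cong suc (sym T≡)) (begin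
      suc T′ + pred (length c′) ≤⟨ +-monoˡ-≤ _ (top-entry j v[j] Ts[j] c′[0]) ⟩
      a′ + pred (length c′)     ≤⟨ head+index≤′ (increasing v[j]) c′[0] bottom-at ⟩
      bottom                    ≤⟨ bottom≤top₁ ⟩
      top₁                      ≡⟨ []=-functional top₁-at c[0] ⟩
      a                         ∎)
    where
    open Adjacent adj
    open ≤-Reasoning
    T≡ : T ≡ T′ + pred (length c′)
    T≡ = trans ([]=-functional Ts[j+1] T₁-at) T₁≡

  row<entry : ∀ {r j e} → (+ r , j , e) ∈ boxes v → suc r ≤ e
  row<entry b∈ with ∈-boxes-natural⁻ tops≡ b∈
  ... | c , T , q , v[j] , Ts[j] , c[q] , refl with []=-head (nonEmpty v[j])
  ...   | a , c[0] = ≤-trans (+-monoˡ-≤ q (top-entry _ v[j] Ts[j] c[0])) (head+index≤′ (increasing v[j]) c[0] c[q])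

  rowBounded : RowBounded v
  rowBounded = record { topRows = Ts ; tops≡ = tops≡ ; row<entry = row<entry }

  rows-increase : ∀ {r j a r′ j′ b} → (+ r , j , a) ∈ boxes v → (+ r′ , j′ , b) ∈ boxes v → j < j′ → r ≤ r′
  rows-increase b∈ b′∈ j<j′ with ∈-boxes-natural⁻ tops≡ b∈ | ∈-boxes-natural⁻ tops≡ b′∈
  ... | c , T , q , v[j] , Ts[j] , c[q] , refl | c′ , T′ , q′ , v[j′] , Ts[j′] , _ , refl with []=-downward v[j′] j<j′
  ...   | c₁ , v[j+1] = begin
    T + q                 ≤⟨ +-monoʳ-≤ T ([]=⇒≤pred-length c[q]) ⟩
    T + pred (length c)   ≡⟨ Adjacent.T₁≡ adj ⟨
    Adjacent.T₁ adj       ≤⟨ ribbonTops-mono {0} {columns v} j<j′ (Adjacent.T₁-at adj) Ts[j′] ⟩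
    T′                    ≤⟨ m≤m+n T′ q′ ⟩
    T′ + q′               ∎
    where
    adj = adjacent v[j] Ts[j] v[j+1]
    open ≤-Reasoning

  entries-increase : ∀ {r j a r′ j′ b} → (+ r , j , a) ∈ boxes v → (+ r′ , j′ , b) ∈ boxes v → j < j′ → a ≤ b
  entries-increase {j = j} b∈ b′∈ j<j′ with ∈-boxes-natural⁻ tops≡ b∈ | ∈-boxes-natural⁻ tops≡ b′∈
  ... | c , T , q , v[j] , Ts[j] , c[q] , refl | c′ , T′ , q′ , v[j′] , _ , c′[q′] , refl with m≤n⇒∃[o]m+o≡n j<j′
  ...   | d , refl = go d j v[j] c[q] v[j′] c′[q′]
    where
    go : ∀ d j {c c′ q q′ a b} → columns v [ j ]= c → c [ q ]= a → columns v [ suc j + d ]= c′ → c′ [ q′ ]= b → a ≤ b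
    go d j {c} {c′} {b = b} v[j] c[q] v[j+1+d] c′[q′] with ribbonTops-[]= {0} v[j] | []=-downward v[j+1+d] (s≤s (m≤m+n j d))
    ... | T , Ts[j] | c₁ , v[j+1] = ≤-trans (column-≤ (increasing v[j]) c[q] bottom-at ([]=⇒≤pred-length c[q])) (≤-trans bottom≤top₁ (top₁≤b d v[j+1+d]))
      where
      open Adjacent (adjacent v[j] Ts[j] v[j+1])
      top₁≤b : ∀ d → columns v [ suc j + d ]= c′ → top₁ ≤ b
      top₁≤b zero    v[j+1]′ rewrite +-identityʳ j with []=-functional v[j+1] v[j+1]′
      ... | refl = column-≤ (increasing v[j+1]) top₁-at c′[q′] z≤n
      top₁≤b (suc d) v[j+2+d] = go d (suc j) v[j+1] top₁-at (subst (λ k → columns v [ suc k ]= c′) (+-suc j d) v[j+2+d]) c′[q′]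

  -- The least misplaced entry can neither sit higher in an earlier column (rows weakly increase
  -- to the right) nor exceed an entry of a later column (entries weakly increase to the right).
  ribbon-signsAround : (m : LeastMisplaced v Ts) → SignsAround (LeastMisplaced.i m) (columns v) (LeastMisplaced.col m)
  ribbon-signsAround m = left , right
    where
    open LeastMisplaced m

    left : ∀ {j c} → j < col → columns v [ j ]= c → PlusOrNone i c
    left {j} {c} j<col v[j] = plusOrNone i c λ i+1∈ → ⊥-elim (absent (mem⇒[]= (suc i) c i+1∈))
      where
      absent : ∃ (λ q → c [ q ]= suc i) → ⊥
      absent (q , c[q]) with ribbonTops-[]= {0} v[j]
      ... | T , Ts[j] with suc (T + q) <? suc i
      ...   | yes q-misplaced = <-irrefl refl (<-≤-trans j<col (leftmost b∈ q-misplaced))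
        where b∈ = ∈-boxes-natural⁺ tops≡ v[j] Ts[j] c[q]
      ...   | no  q-placed    = <-irrefl refl (<-≤-trans (≤-pred misplaced) (≤-trans (≤-pred (≮⇒≥ q-placed)) (rows-increase b∈ box j<col)))
        where b∈ = ∈-boxes-natural⁺ tops≡ v[j] Ts[j] c[q]

    right : ∀ {j c} → col < j → columns v [ j ]= c → MinusOrNone i c
    right {j} {c} col<j v[j] = minusOrNone i c λ i∈ → ⊥-elim (absent (mem⇒[]= i c i∈))
      where
      absent : ∃ (λ q → c [ q ]= i) → ⊥
      absent (q , c[q]) with ribbonTops-[]= {0} v[j]
      ... | T , Ts[j] = <-irrefl refl (entries-increase box (∈-boxes-natural⁺ tops≡ v[j] Ts[j] c[q]) col<j)

  open Superstandard v∈ rowBounded using (∈-superstandard⁺; superstandard∈)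

  -- The top entry T + 1 of column j + 1 of the superstandard ribbon shares its row with the bottom
  -- entry T + 1 of column j, so turning it into T breaks the rows.
  lowering-top-breaks-row : ∀ {j c T} → columns v [ suc j ]= c → Ts [ suc j ]= T →
    ¬ InScol n (modifyCol (suc j) (replaceEntry (suc T) T) (superstandard v))
  lowering-top-breaks-row {j} {c} {T} v[j+1] Ts[j+1] d∈ with []=-downward v[j+1] (n≤1+n j)
  ... | c₀ , v[j] with ribbonTops-[]= {0} v[j]
  ...   | T₀ , Ts[j] with adjacent v[j] Ts[j] v[j+1] | []=-head (nonEmpty v[j+1])
  ...     | adj | a , c[0] = <-irrefl refl (proj₂ (proj₂ d∈) left right (n<1+n j))
    where
    open Adjacent adj
    d = modifyCol (suc j) (map (lower T)) (superstandard v)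

    T≡ : T₀ + pred (length c₀) ≡ T
    T≡ = sym (trans ([]=-functional Ts[j+1] T₁-at) T₁≡)

    left : (+ T , j , suc T) ∈ boxes d
    left = subst (λ x → (+ x , j , suc x) ∈ boxes d) T≡
             (subst (λ e → (_ , j , e) ∈ boxes d) (if-≡ᵇ-other (<⇒≢ (n<1+n j)))
               (∈-boxes-modifyCol⁺ {suc j} {lower T} {superstandard v}
                 (∈-superstandard⁺ (∈-boxes-natural⁺ tops≡ v[j] Ts[j] bottom-at))))

    right : (+ T , suc j , T) ∈ boxes d
    right = subst (λ r → (r , suc j , T) ∈ boxes d) (cong +_ (+-identityʳ T))
              (subst (λ e → (_ , suc j , e) ∈ boxes d)
                     (trans (if-≡ᵇ-same (suc j)) (trans (cong (lower T ∘ suc) (+-identityʳ T)) (replace-same (suc T) T)))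
                (∈-boxes-modifyCol⁺ {suc j} {lower T} {superstandard v}
                  (∈-superstandard⁺ (∈-boxes-natural⁺ tops≡ v[j+1] Ts[j+1] c[0]))))

  -- A column T + 1, …, T + l of the superstandard ribbon carries an unmatched − only for i = T, and
  -- T ≥ 1 occurs only in columns after the first.
  ribbon-superstandard-highest : HighestWeight n (superstandard v)
  ribbon-superstandard-highest = superstandard∈ , λ i (1≤i , _) d (ec , d∈) → no-eStep i 1≤i d ec d∈
    where
    no-eStep : ∀ i → 1 ≤ i → ∀ d → eCand i (superstandard v) ≡ just d → ¬ InScol n d
    no-eStep i 1≤i d ec d∈ with eCand⇒modifyCol i (superstandard v) d ec
    ... | m , c′ , refl , ss[m] , i∉ , i+1∈ with []=-superstandard⁻ {v} ss[m]
    ...   | t , c , tops[m] , v[m] , refl with []=-map⁻ +_ (subst (_[ m ]= t) tops≡ tops[m])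
    ...     | T , Ts[m] , refl with mem⇒[]= (suc i) (consecutive T (length c)) i+1∈
    ...       | q , c′[q] with []=-consecutive⁻ c′[q]
    ...         | q<l , i+1≡ = at q m (suc-injective i+1≡) q<l v[m] Ts[m] d∈
      where
      at : ∀ q m → i ≡ T + q → q < length c → columns v [ m ]= c → Ts [ m ]= T →
           ¬ InScol n (modifyCol m (replaceEntry (suc i) i) (superstandard v))
      at (suc q) m i≡ q+1<l _ _ _ with trans (sym ([]=⇒mem ([]=-consecutive⁺ {T} {length c} (<-trans (n<1+n q) q+1<l))))
                                            (subst (λ x → mem x (consecutive T (length c)) ≡ false) (trans i≡ (+-suc T q)) i∉)
      ... | ()
      at zero zero     i≡ _ _ Ts[0] _ = <-irrefl (sym (trans i≡ (trans (+-identityʳ T) (ribbonTops-zero {0} {columns v} Ts[0])))) 1≤i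
      at zero (suc m)  i≡ _ v[m+1] Ts[m+1] =
        lowering-top-breaks-row v[m+1] Ts[m+1] ∘ subst (λ x → InScol n (modifyCol (suc m) (replaceEntry (suc x) x) (superstandard v))) (trans i≡ (+-identityʳ T))

ribbonGluing : ℕ → List ℕ → List ℤ
ribbonGluing a []      = []
ribbonGluing a (b ∷ L) = (+ a ℤ.+ + b ℤ.- + 1) ∷ ribbonGluing b L

QRGlue⇒ribbonGluing : ∀ c rs → QRGlue c rs → map proj₁ rs ≡ ribbonGluing (length c) (map length (map proj₂ rs))
QRGlue⇒ribbonGluing c []              _           = refl
QRGlue⇒ribbonGluing c ((p , c′) ∷ rs) (p≡ , glued) = cong₂ _∷_ p≡ (QRGlue⇒ribbonGluing c′ rs glued)

ribbonGluing⇒QRGlue : ∀ c rs → map proj₁ rs ≡ ribbonGluing (length c) (map length (map proj₂ rs)) → QRGlue c rs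
ribbonGluing⇒QRGlue c []              _  = _
ribbonGluing⇒QRGlue c ((p , c′) ∷ rs) eq = ∷-injectiveˡ eq , ribbonGluing⇒QRGlue c′ rs (∷-injectiveʳ eq)

RibbonGlued : SCol → Set
RibbonGlued v = QRGlue (first v) (rest v)

gluing≡ribbonGluing : ∀ {v} → RibbonGlued v → gluing v ≡ ribbonGluing (length (first v)) (map length (map proj₂ (rest v)))
gluing≡ribbonGluing {v} = QRGlue⇒ribbonGluing (first v) (rest v)

ribbon-glued-cong : ∀ {v w} → lengths v ≡ lengths w → gluing v ≡ gluing w → RibbonGlued v → RibbonGlued w
ribbon-glued-cong {v} {w} lengths≡ gluing≡ glued = ribbonGluing⇒QRGlue (first w) (rest w)
  (trans (sym gluing≡) (trans (gluing≡ribbonGluing {v} glued) (cong₂ ribbonGluing (∷-injectiveˡ lengths≡) (∷-injectiveʳ lengths≡))))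

ribbonRowCount : ℕ → List ℕ → ℕ → ℕ
ribbonRowCount T []      k = 0
ribbonRowCount T (l ∷ L) k = meets T l k + ribbonRowCount (T + pred l) L k

rowCount-ribbonTops : ∀ T (cs : List Col) k → rowCount (ribbonTops T cs) (map length cs) k ≡ ribbonRowCount T (map length cs) k
rowCount-ribbonTops T []       k = refl
rowCount-ribbonTops T (c ∷ cs) k = cong (_+_ (meets T (length c) k)) (rowCount-ribbonTops _ cs k)

ribbonRowCount-above : ∀ T L k → k < T → ribbonRowCount T L k ≡ 0
ribbonRowCount-above T []      k k<T = refl
ribbonRowCount-above T (l ∷ L) k k<T rewrite meets-above T l k k<T = ribbonRowCount-above (T + pred l) L k (<-≤-trans k<T (m≤m+n T _))

ribbonRowCount-within : ∀ T l L k → T ≤ k → k < T + l → 1 ≤ ribbonRowCount T (l ∷ L) k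
ribbonRowCount-within T l L k T≤k k<T+l rewrite meets-inside T l k T≤k k<T+l = s≤s z≤n

private
  pred< : ∀ {l} → 1 ≤ l → pred l < l
  pred< {suc l} _ = n<1+n l

  pred-<-mono : ∀ {m l} → 1 ≤ m → m < l → pred m < pred l
  pred-<-mono {suc m} {suc l} _ (s≤s m<l) = m<l

  -- Consecutive columns of a ribbon share exactly one row: if m < l, row T + pred m meets two
  -- columns of the second ribbon but only the first column of the first one.
  ribbon-head-≤ : ∀ T l L m M → 1 ≤ l → 1 ≤ m → All (1 ≤_) M →
    (∀ k → ribbonRowCount T (l ∷ L) k ≡ ribbonRowCount T (m ∷ M) k) → l ≤ m
  ribbon-head-≤ T l L m M 1≤l 1≤m M⁺ counts≡ with l ≤? m
  ... | yes l≤m = l≤m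
  ... | no  l≰m = ⊥-elim (differ M M⁺ counts≡)
    where
    m<l : m < l
    m<l = ≰⇒> l≰m
    differ : ∀ M → All (1 ≤_) M → (∀ k → ribbonRowCount T (l ∷ L) k ≡ ribbonRowCount T (m ∷ M) k) → ⊥
    differ []       _ counts≡ = <⇒≢ (ribbonRowCount-within T l L (T + m) (m≤m+n T m) (+-monoʳ-< T m<l))
                            (sym (trans (counts≡ (T + m)) (cong (_+ 0) (meets-below T m (T + m) ≤-refl))))
    differ (m′ ∷ M′) (1≤m′ ∷ _) counts≡ = <-irrefl refl (<-≤-trans two≤ (≤-reflexive (trans (sym (counts≡ k)) one)))
      where
      k = T + pred m
      one : ribbonRowCount T (l ∷ L) k ≡ 1
      one rewrite meets-inside T l k (m≤m+n T _) (+-monoʳ-< T (<-trans (pred-<-mono 1≤m m<l) (pred< 1≤l)))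
                | ribbonRowCount-above (T + pred l) L k (+-monoʳ-< T (pred-<-mono 1≤m m<l)) = refl
      two≤ : 1 < ribbonRowCount T (m ∷ m′ ∷ M′) k
      two≤ rewrite meets-inside T m k (m≤m+n T _) (+-monoʳ-< T (pred< 1≤m))
                 | meets-inside (T + pred m) m′ k ≤-refl (subst (_< k + m′) (+-identityʳ k) (+-monoʳ-< k 1≤m′)) = s≤s (s≤s z≤n)

ribbonRowCount-injective : ∀ T L M → All (1 ≤_) L → All (1 ≤_) M →
  (∀ k → ribbonRowCount T L k ≡ ribbonRowCount T M k) → L ≡ M
ribbonRowCount-injective T []      []      _ _ _ = refl
ribbonRowCount-injective T []      (m ∷ M) _ (1≤m ∷ _) counts≡ =
  ⊥-elim (<⇒≢ (ribbonRowCount-within T m M T ≤-refl (subst (_< T + m) (+-identityʳ T) (+-monoʳ-< T 1≤m))) (counts≡ T))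
ribbonRowCount-injective T (l ∷ L) []      (1≤l ∷ _) _ counts≡ =
  ⊥-elim (<⇒≢ (ribbonRowCount-within T l L T ≤-refl (subst (_< T + l) (+-identityʳ T) (+-monoʳ-< T 1≤l))) (sym (counts≡ T)))
ribbonRowCount-injective T (l ∷ L) (m ∷ M) (1≤l ∷ L⁺) (1≤m ∷ M⁺) counts≡
  with ≤-antisym (ribbon-head-≤ T l L m M 1≤l 1≤m M⁺ counts≡) (ribbon-head-≤ T m M l L 1≤m 1≤l L⁺ (sym ∘ counts≡))
... | refl = cong (l ∷_) (ribbonRowCount-injective (T + pred l) L M L⁺ M⁺ λ k → +-cancelˡ-≡ (meets T l k) _ _ (counts≡ k))

ribbon-shape⇒superstandard≡ : ∀ {n v w} → InScol n v → RibbonGlued v → InScol n w → RibbonGlued w →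
  shape v ≡ shape w → superstandard v ≡ superstandard w
ribbon-shape⇒superstandard≡ {v = v} {w} v∈ glued-v w∈ glued-w shape≡ = superstandard-cong v w lengths≡ gluing≡
  where
  rowCounts≡ = shape≡⇒rowCount≡ v w (RibbonGeometry.tops≡ v∈ glued-v) (proj₁ (All.head (proj₁ v∈)))
                                    (RibbonGeometry.tops≡ w∈ glued-w) (proj₁ (All.head (proj₁ w∈))) shape≡
  lengths≡ : lengths v ≡ lengths w
  lengths≡ = ribbonRowCount-injective 0 (lengths v) (lengths w) (lengths-positive (proj₁ v∈)) (lengths-positive (proj₁ w∈))
               λ k → trans (sym (rowCount-ribbonTops 0 (columns v) k)) (trans (rowCounts≡ k) (rowCount-ribbonTops 0 (columns w) k))
  gluing≡ : gluing v ≡ gluing w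
  gluing≡ = trans (gluing≡ribbonGluing {v} glued-v)
                  (trans (cong₂ ribbonGluing (∷-injectiveˡ lengths≡) (∷-injectiveʳ lengths≡)) (sym (gluing≡ribbonGluing {w} glued-w)))

quasiRibbonTableaux : ∀ n → TableauClass n
quasiRibbonTableaux n = record
  { Glued                 = RibbonGlued
  ; rowBounded            = RibbonGeometry.rowBounded
  ; signsAround           = RibbonGeometry.ribbon-signsAround
  ; glued-cong            = λ {v} {w} → ribbon-glued-cong {v} {w}
  ; superstandard-highest = RibbonGeometry.ribbon-superstandard-highest
  ; shape⇒superstandard≡  = ribbon-shape⇒superstandard≡
  }

proposition3p3p7 : ∀ (n : ℕ) → 1 ≤ n → ∀ (w : SCol) →
    (YoungTableau n w → IsComponentWithUniqueHW n (YoungTableau n) w)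
    × (QuasiRibbonTableau n w → IsComponentWithUniqueHW n (QuasiRibbonTableau n) w)
proposition3p3p7 n _ w =
  Component.isComponentWithUniqueHW (youngTableaux n) w , Component.isComponentWithUniqueHW (quasiRibbonTableaux n) w
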